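{- Let $F_{\underline{321}}(x,t)=\sum_{n\ge0}\sum_{\pi\in\mathbf S_n(132,\underline{123})}x^nt^{\mathrm{occ}_{321}(\pi)}$. Then $$F_{\underline{321}}(x,t)=\frac{1-xt-x^2G+x-x^2t+x^2-x^3t+x^3}{ -x^2+1-xt-x^2G},\qquad G=\frac{ -b-\sqrt{b^2-4a}}{2a},$$ with $a=x^2$ and $b=-1+xt$.
   Context: $\mathbf S_n(132,\underline{123})$ is the set of $\pi\in\mathbf S_n$ with no subsequence order-isomorphic to $132$ and no three consecutive entries order-isomorphic to $123$. $\mathrm{occ}_{321}(\pi)$ is the number of indices $i$ such that $\pi_i\pi_{i+1}\pi_{i+2}$ is order-isomorphic to $321$. -}

module Defs where

open import Data.Nat using (ℕ; zero; suc; _∸_; _<_; _>_)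
open import Data.Integer as ℤ using (ℤ; +_; -_)
open import Data.List using (List; []; _∷_; length; map; upTo; foldr)
import Data.List as L
open import Data.List.Membership.Propositional using (_∈_)
open import Data.List.Relation.Unary.Unique.Propositional using (Unique)
open import Data.List.Relation.Binary.Permutation.Propositional using (_↭_)
open import Data.List.Relation.Binary.Sublist.Propositional using (_⊆_)
open import Data.Product using (Σ; ∃; _×_; _,_)
open import Relation.Binary.PropositionalEquality using (_≡_)
open import Relation.Nullary using (¬_; yes; no)
open import Data.Nat using (_<?_)
open import Relation.Nullary.Decidable using (⌊_⌋)
open import Data.Bool using (Bool; true; false; _∧_; if_then_else_)
open import Function.Bundles using (_⇔_)

-- Permutations of length n: lists that are rearrangements of [0,…,n-1]
-- (values 0..n-1 instead of 1..n; patterns only depend on relative order).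

IsPerm : ℕ → List ℕ → Set
IsPerm n σ = σ ↭ upTo n

Contains132 : List ℕ → Set
Contains132 σ = ∃ λ a → ∃ λ b → ∃ λ c →
  ((a ∷ b ∷ c ∷ []) ⊆ σ) × (a < c) × (c < b)

Contains123c : List ℕ → Set
Contains123c σ = ∃ λ pre → ∃ λ a → ∃ λ b → ∃ λ c → ∃ λ post →
  (σ ≡ pre L.++ (a ∷ b ∷ c ∷ post)) × (a < b) × (b < c)

InS : ℕ → List ℕ → Set
InS n σ = IsPerm n σ × ¬ Contains132 σ × ¬ Contains123c σ

occ321 : List ℕ → ℕ
occ321 (a ∷ b ∷ c ∷ r) =
  (if ⌊ b <? a ⌋ ∧ ⌊ c <? b ⌋ then 1 else 0) Data.Nat.+ occ321 (b ∷ c ∷ r)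
occ321 _ = 0

IsCount : (List ℕ → Set) → ℕ → Set
IsCount P c = Σ (List (List ℕ)) λ Ls →
  Unique Ls × (∀ σ → (σ ∈ Ls) ⇔ P σ) × (length Ls ≡ c)

-- Formal power series in x, t with integer coefficients:
-- S n k = coefficient of x^n t^k.

Ser : Set
Ser = ℕ → ℕ → ℤ

infixl 6 _⊕_ _⊖_
infixl 7 _⊛_
infix 4 _≐_

_⊕_ : Ser → Ser → Ser
(A ⊕ B) n k = A n k ℤ.+ B n k

_⊖_ : Ser → Ser → Ser
(A ⊖ B) n k = A n k ℤ.- B n k

sumℤ : List ℤ → ℤ
sumℤ = foldr ℤ._+_ (+ 0)

_⊛_ : Ser → Ser → Ser
(A ⊛ B) n k =
  sumℤ (map (λ i → sumℤ (map (λ j → A i j ℤ.* B (n ∸ i) (k ∸ j)) (upTo (suc k))))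
           (upTo (suc n)))

mono : ℕ → ℕ → Ser
mono a b n k with n Data.Nat.≟ a | k Data.Nat.≟ b
... | yes _ | yes _ = + 1
... | _ | _ = + 0

one : Ser
one = mono 0 0

_≐_ : Ser → Ser → Set
A ≐ B = ∀ n k → A n k ≡ B n k

ofℕ : (ℕ → ℕ → ℕ) → Ser
ofℕ f n k = + f n k

module Submission where

-- The maximum n of σ ∈ S_{n+1}(132, 123) splits it as α' n β;
-- avoiding 132 puts α' above β, so σ is the join of α ∈ S_m, β ∈ S_{n-m},
-- and avoiding consecutive 123 means α has no final ascent.  Conversely such
-- joins lie in the class, with occ321 σ = occ321 α + occ321 β + [β starts
-- with a descent].  So class counts are Cauchy products (Products), and
-- splitting by the position of the maximum gives four functional equations
-- for the series F, A, A', B of four classes (FunctionalEquations).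
--
-- A shifted combination H of A and A' solves the
-- equation of G, whose solution is unique (UniqueSolution), so H = G; an
-- explicit polynomial certificate eliminates A, A', B (Elimination).

open import Defs
open import Data.Nat using (ℕ)
open import Data.Product using (_×_)
open import Relation.Binary.PropositionalEquality using (_≡_)
open import Algebra using (CommutativeRing)

module PowerSeries {c ℓ} (R : CommutativeRing c ℓ) where
  open CommutativeRing R
  open import Data.Nat using (ℕ; zero; suc; _∸_; _≤_; s≤s; z≤n)
  open import Data.Nat.Properties using (≤-refl; m≤n⇒m≤1+n)
  open import Data.Product using (_,_)
  open import Function using (_∘_)
  import Algebra.Solver.Ring.NaturalCoefficients.Default as NaturalSolver
  module S = NaturalSolver commutativeSemiring
  open import Relation.Binary.Reasoning.Setoid setoid

  Series : Set c
  Series = ℕ → Carrier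

  infix 4 _≋_
  _≋_ : Series → Series → Set ℓ
  f ≋ g = ∀ n → f n ≈ g n

  ≋-trans : ∀ {a b d} → a ≋ b → b ≋ d → a ≋ d
  ≋-trans e f n = trans (e n) (f n)

  Σ< : (ℕ → Carrier) → ℕ → Carrier
  Σ< f zero = 0#
  Σ< f (suc n) = f 0 + Σ< (f ∘ suc) n

  Σ<-cong : ∀ {f g} n → (∀ i → f i ≈ g i) → Σ< f n ≈ Σ< g n
  Σ<-cong zero e = refl
  Σ<-cong (suc n) e = +-cong (e 0) (Σ<-cong n (λ i → e (suc i)))

  conv : Series → Series → Series
  conv a b n = Σ< (λ i → a i * b (n ∸ i)) (suc n)

  _+ˢ_ : Series → Series → Series
  (a +ˢ b) n = a n + b n

  -ˢ_ : Series → Series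
  (-ˢ a) n = - a n

  0ˢ : Series
  0ˢ _ = 0#

  const : Carrier → Series
  const s zero = s
  const s (suc _) = 0#

  1ˢ : Series
  1ˢ = const 1#

  shift : Series → Series
  shift a zero = 0#
  shift a (suc n) = a n

  scale : Carrier → Series → Series
  scale s a n = s * a n

  tail : Series → Series
  tail a = a ∘ suc

  conv-cong : ∀ {a a' b b'} → a ≋ a' → b ≋ b' → conv a b ≋ conv a' b'
  conv-cong ea eb n = Σ<-cong (suc n) (λ i → *-cong (ea i) (eb (n ∸ i)))

  conv-cong≤ : ∀ n {a a' b b'} → (∀ i → i ≤ n → a i ≈ a' i) → (∀ i → i ≤ n → b i ≈ b' i) →
               conv a b n ≈ conv a' b' n
  conv-cong≤ zero ea eb = +-congʳ (*-cong (ea 0 z≤n) (eb 0 z≤n))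
  conv-cong≤ (suc n) ea eb =
    +-cong (*-cong (ea 0 z≤n) (eb (suc n) ≤-refl))
           (conv-cong≤ n (λ i p → ea (suc i) (s≤s p)) (λ i p → eb i (m≤n⇒m≤1+n p)))

  conv-sucʳ : ∀ n a b → conv a b (suc n) ≈ a (suc n) * b 0 + conv a (tail b) n
  conv-sucʳ zero a b = S.solve 4 (λ a0 b1 a1 b0 →
    a0 S.:* b1 S.:+ (a1 S.:* b0 S.:+ S.con 0) S.:= a1 S.:* b0 S.:+ (a0 S.:* b1 S.:+ S.con 0))
    refl (a 0) (b 1) (a 1) (b 0)
  conv-sucʳ (suc n) a b = begin
    a 0 * b (suc (suc n)) + conv (tail a) b (suc n)
      ≈⟨ +-congˡ (conv-sucʳ n (tail a) b) ⟩
    a 0 * b (suc (suc n)) + (a (suc (suc n)) * b 0 + conv (tail a) (tail b) n)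
      ≈⟨ S.solve 3 (λ x y z → x S.:+ (y S.:+ z) S.:= y S.:+ (x S.:+ z)) refl
           (a 0 * b (suc (suc n))) (a (suc (suc n)) * b 0) (conv (tail a) (tail b) n) ⟩
    a (suc (suc n)) * b 0 + (a 0 * b (suc (suc n)) + conv (tail a) (tail b) n) ∎

  conv-comm : ∀ a b → conv a b ≋ conv b a
  conv-comm a b zero = +-congʳ (*-comm (a 0) (b 0))
  conv-comm a b (suc n) = begin
    a 0 * b (suc n) + conv (tail a) b n ≈⟨ +-cong (*-comm _ _) (conv-comm (tail a) b n) ⟩
    b (suc n) * a 0 + conv b (tail a) n ≈⟨ sym (conv-sucʳ n b a) ⟩
    conv b a (suc n)                     ∎

  conv-distribˡ : ∀ a b b' → conv a (b +ˢ b') ≋ (conv a b +ˢ conv a b')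
  conv-distribˡ a b b' zero = S.solve 3 (λ x y z →
    x S.:* (y S.:+ z) S.:+ S.con 0 S.:= (x S.:* y S.:+ S.con 0) S.:+ (x S.:* z S.:+ S.con 0))
    refl (a 0) (b 0) (b' 0)
  conv-distribˡ a b b' (suc n) = begin
    a 0 * (b (suc n) + b' (suc n)) + conv (tail a) (b +ˢ b') n
      ≈⟨ +-congˡ (conv-distribˡ (tail a) b b' n) ⟩
    a 0 * (b (suc n) + b' (suc n)) + (conv (tail a) b n + conv (tail a) b' n)
      ≈⟨ S.solve 5 (λ x y z u v → x S.:* (y S.:+ z) S.:+ (u S.:+ v) S.:= (x S.:* y S.:+ u) S.:+ (x S.:* z S.:+ v))
           refl _ _ _ _ _ ⟩
    (a 0 * b (suc n) + conv (tail a) b n) + (a 0 * b' (suc n) + conv (tail a) b' n) ∎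

  conv-scale : ∀ s a b → conv (scale s a) b ≋ scale s (conv a b)
  conv-scale s a b zero = S.solve 3 (λ x y z → x S.:* y S.:* z S.:+ S.con 0 S.:= x S.:* (y S.:* z S.:+ S.con 0))
    refl s (a 0) (b 0)
  conv-scale s a b (suc n) = begin
    s * a 0 * b (suc n) + conv (tail (scale s a)) b n ≈⟨ +-congˡ (conv-scale s (tail a) b n) ⟩
    s * a 0 * b (suc n) + s * conv (tail a) b n
      ≈⟨ S.solve 4 (λ x y z w → x S.:* y S.:* z S.:+ x S.:* w S.:= x S.:* (y S.:* z S.:+ w)) refl _ _ _ _ ⟩
    s * (a 0 * b (suc n) + conv (tail a) b n)          ∎

  conv-zeroˡ : ∀ a b → (∀ n → a n ≈ 0#) → conv a b ≋ 0ˢ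
  conv-zeroˡ a b z zero = trans (+-congʳ (trans (*-congʳ (z 0)) (zeroˡ _))) (+-identityˡ _)
  conv-zeroˡ a b z (suc n) =
    trans (+-cong (trans (*-congʳ (z 0)) (zeroˡ _)) (conv-zeroˡ (tail a) b (λ i → z (suc i)) n)) (+-identityˡ _)

  conv-identityˡ : ∀ b → conv 1ˢ b ≋ b
  conv-identityˡ b zero = trans (+-identityʳ _) (*-identityˡ _)
  conv-identityˡ b (suc n) = trans (+-cong (*-identityˡ _) (conv-zeroˡ (tail 1ˢ) b (λ _ → refl) n)) (+-identityʳ _)

  -- associativity, by induction on the degree: the tail of a product a·b is
  -- a₀·(tail b) + (tail a)·b
  conv-assoc : ∀ a b d → conv (conv a b) d ≋ conv a (conv b d)
  conv-assoc a b d zero = S.solve 3 (λ x y z →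
    (x S.:* y S.:+ S.con 0) S.:* z S.:+ S.con 0 S.:= x S.:* (y S.:* z S.:+ S.con 0) S.:+ S.con 0)
    refl (a 0) (b 0) (d 0)
  conv-assoc a b d (suc n) = begin
    conv a b 0 * d (suc n) + conv (tail (conv a b)) d n
      ≈⟨ +-congˡ tail-step ⟩
    conv a b 0 * d (suc n) + (a 0 * conv (tail b) d n + conv (tail a) (conv b d) n)
      ≈⟨ S.solve 5 (λ x y z u w → (x S.:* y S.:+ S.con 0) S.:* z S.:+ (x S.:* u S.:+ w) S.:=
                                   x S.:* (y S.:* z S.:+ u) S.:+ w)
           refl (a 0) (b 0) (d (suc n)) (conv (tail b) d n) (conv (tail a) (conv b d) n) ⟩
    a 0 * conv b d (suc n) + conv (tail a) (conv b d) n ∎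
    where
    u v : Series
    u = scale (a 0) (tail b)
    v = conv (tail a) b
    tail-step : conv (tail (conv a b)) d n ≈ a 0 * conv (tail b) d n + conv (tail a) (conv b d) n
    tail-step = begin
      conv (tail (conv a b)) d n ≈⟨ conv-cong {tail (conv a b)} {u +ˢ v} {d} {d} (λ _ → refl) (λ _ → refl) n ⟩
      conv (u +ˢ v) d n          ≈⟨ conv-comm (u +ˢ v) d n ⟩
      conv d (u +ˢ v) n          ≈⟨ conv-distribˡ d u v n ⟩
      conv d u n + conv d v n    ≈⟨ +-cong (conv-comm d u n) (conv-comm d v n) ⟩
      conv u d n + conv v d n    ≈⟨ +-cong (conv-scale (a 0) (tail b) d n) (conv-assoc (tail a) b d n) ⟩
      a 0 * conv (tail b) d n + conv (tail a) (conv b d) n ∎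

  import Algebra.Structures {A = Series} _≋_ as Structures

  seriesIsCommutativeRing : Structures.IsCommutativeRing _+ˢ_ conv -ˢ_ 0ˢ 1ˢ
  seriesIsCommutativeRing = record
    { isRing = record
      { +-isAbelianGroup = record
        { isGroup = record
          { isMonoid = record
            { isSemigroup = record
              { isMagma = record
                { isEquivalence = record
                  { refl = λ n → refl ; sym = λ e n → sym (e n) ; trans = ≋-trans }
                ; ∙-cong = λ e f n → +-cong (e n) (f n) }
              ; assoc = λ x y z n → +-assoc (x n) (y n) (z n) }
            ; identity = (λ x n → +-identityˡ (x n)) , (λ x n → +-identityʳ (x n)) }
          ; inverse = (λ x n → -‿inverseˡ (x n)) , (λ x n → -‿inverseʳ (x n))
          ; ⁻¹-cong = λ e n → -‿cong (e n) }
        ; comm = λ x y n → +-comm (x n) (y n) }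
      ; *-cong = conv-cong
      ; *-assoc = conv-assoc
      ; *-identity = conv-identityˡ , (λ x n → trans (conv-comm x 1ˢ n) (conv-identityˡ x n))
      ; distrib = conv-distribˡ , λ x y z n →
          trans (conv-comm (y +ˢ z) x n) (trans (conv-distribˡ x y z n) (+-cong (conv-comm x y n) (conv-comm x z n))) }
    ; *-comm = conv-comm }

  seriesRing : CommutativeRing c ℓ
  seriesRing = record { isCommutativeRing = seriesIsCommutativeRing }

  conv-const : ∀ s b → conv (const s) b ≋ scale s b
  conv-const s b zero = +-identityʳ _
  conv-const s b (suc n) = trans (+-congˡ (conv-zeroˡ (tail (const s)) b (λ _ → refl) n)) (+-identityʳ _)

  scale-const : ∀ s u → scale s (const u) ≋ const (s * u)
  scale-const s u zero = refl
  scale-const s u (suc n) = zeroʳ s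

  conv-shift : ∀ u b → conv (shift u) b ≋ shift (conv u b)
  conv-shift u b zero = trans (+-identityʳ _) (zeroˡ _)
  conv-shift u b (suc n) = trans (+-congʳ (zeroˡ _)) (+-identityˡ _)

  shift-cong : ∀ {a b} → a ≋ b → shift a ≋ shift b
  shift-cong e zero = refl
  shift-cong e (suc n) = e n

  const-cong : ∀ {a b} → a ≈ b → const a ≋ const b
  const-cong e zero = e
  const-cong e (suc n) = refl


-- The series of Defs (coefficient of xⁿtᵏ at n k) are power series in x over
-- the ring ℤ[[t]].  The product ⊛ of Defs is the Cauchy product of this ring,
-- so the ring solver for ℤ-algebras becomes available for them.
module Bivariate where

  open import Data.Nat as ℕ using (ℕ; zero; suc; _∸_)
  open import Data.Integer as ℤ using (ℤ; +_)
  import Data.Integer.Properties as ℤP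
  open import Data.List using (map; upTo; applyUpTo)
  open import Function using (_∘_; id)
  open import Relation.Binary.PropositionalEquality as Eq using (_≡_; refl; cong; cong₂)
  open import Relation.Nullary using (yes; no)
  open import Data.Maybe using (Maybe; just; nothing)
  open import Algebra.Solver.Ring.AlmostCommutativeRing
    using (AlmostCommutativeRing; _-Raw-AlmostCommutative⟶_; fromCommutativeRing)

  module Zt = PowerSeries ℤP.+-*-commutativeRing
  module Ztx = PowerSeries Zt.seriesRing

  SerRing : CommutativeRing _ _
  SerRing = Ztx.seriesRing

  sum-applyUpTo : ∀ (g : ℕ → ℤ) h m → sumℤ (map g (applyUpTo h m)) ≡ Zt.Σ< (g ∘ h) m
  sum-applyUpTo g h zero = refl
  sum-applyUpTo g h (suc m) = cong (λ z → g (h 0) ℤ.+ z) (sum-applyUpTo g (h ∘ suc) m)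

  Σ<-coefficient : ∀ (F : ℕ → Zt.Series) m k → Ztx.Σ< F m k ≡ Zt.Σ< (λ i → F i k) m
  Σ<-coefficient F zero k = refl
  Σ<-coefficient F (suc m) k = cong (λ z → F 0 k ℤ.+ z) (Σ<-coefficient (F ∘ suc) m k)

  Σ<-congℤ : ∀ {f g : ℕ → ℤ} m → (∀ i → f i ≡ g i) → Zt.Σ< f m ≡ Zt.Σ< g m
  Σ<-congℤ zero e = refl
  Σ<-congℤ (suc m) e = cong₂ ℤ._+_ (e 0) (Σ<-congℤ m (λ i → e (suc i)))

  ⊛≐conv : ∀ A B → A ⊛ B ≐ Ztx.conv A B
  ⊛≐conv A B n k =
    Eq.trans (sum-applyUpTo (λ i → sumℤ (map (λ j → A i j ℤ.* B (n ∸ i) (k ∸ j)) (upTo (suc k)))) id (suc n))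
    (Eq.trans (Σ<-congℤ (suc n) (λ i → sum-applyUpTo (λ j → A i j ℤ.* B (n ∸ i) (k ∸ j)) id (suc k)))
              (Eq.sym (Σ<-coefficient (λ i → Zt.conv (A i) (B (n ∸ i))) (suc n) k)))

  open CommutativeRing SerRing using (_+_; _*_; -_)
    renaming (_≈_ to _≈ˢ_)

  embed : ℤ → Ser
  embed z = Ztx.const (Zt.const z)

  embed-+ : ∀ a b → embed (a ℤ.+ b) ≈ˢ embed a + embed b
  embed-+ a b zero zero = refl
  embed-+ a b zero (suc k) = refl
  embed-+ a b (suc n) k = refl

  embed-- : ∀ a → embed (ℤ.- a) ≈ˢ - embed a
  embed-- a zero zero = refl
  embed-- a zero (suc k) = refl
  embed-- a (suc n) k = refl

  embed-* : ∀ a b → embed (a ℤ.* b) ≈ˢ embed a * embed b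
  embed-* a b = CommutativeRing.sym SerRing λ n →
    Zt.≋-trans (Ztx.conv-const (Zt.const a) (embed b) n)
    (Zt.≋-trans (Ztx.scale-const (Zt.const a) (Zt.const b) n)
                (Ztx.const-cong (λ k → Eq.trans (Zt.conv-const a (Zt.const b) k) (Zt.scale-const a b k)) n))

  embedding : CommutativeRing.rawRing ℤP.+-*-commutativeRing -Raw-AlmostCommutative⟶ fromCommutativeRing SerRing
  embedding = record
    { ⟦_⟧ = embed
    ; +-homo = embed-+
    ; *-homo = embed-*
    ; -‿homo = embed--
    ; 0-homo = λ { zero zero → refl ; zero (suc k) → refl ; (suc n) k → refl }
    ; 1-homo = λ n k → refl }

  embed-≟ : ∀ a b → Maybe (embed a ≈ˢ embed b)
  embed-≟ a b with a ℤ.≟ b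
  ... | yes refl = just (λ n k → refl)
  ... | no _ = nothing

  import Algebra.Solver.Ring as RingSolver
  module Solver = RingSolver (CommutativeRing.rawRing ℤP.+-*-commutativeRing)
                             (fromCommutativeRing SerRing) embedding embed-≟


module Monomials where

  open import Data.Nat as ℕ using (ℕ; zero; suc)
  open import Data.Integer using (+_)
  open import Relation.Binary.PropositionalEquality as Eq using (_≡_; refl; _≢_; cong)
  open import Relation.Nullary using (yes; no)
  open import Data.Sum using (_⊎_; inj₁; inj₂)
  open import Data.Empty using (⊥-elim)
  open Bivariate
  open CommutativeRing SerRing hiding (refl; zero)
  open import Relation.Binary.Reasoning.Setoid setoid

  X T : Ser
  X = Ztx.shift 1#
  T = Ztx.const (Zt.shift Zt.1ˢ)

  tPower : ℕ → Zt.Series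
  tPower zero = Zt.1ˢ
  tPower (suc b) = Zt.shift (tPower b)

  monomial : ℕ → ℕ → Ser
  monomial zero b = Ztx.const (tPower b)
  monomial (suc a) b = Ztx.shift (monomial a b)

  tPower-diag : ∀ b → tPower b b ≡ + 1
  tPower-diag zero = refl
  tPower-diag (suc b) = tPower-diag b

  tPower-off : ∀ b k → k ≢ b → tPower b k ≡ + 0
  tPower-off zero zero ne = ⊥-elim (ne refl)
  tPower-off zero (suc k) ne = refl
  tPower-off (suc b) zero ne = refl
  tPower-off (suc b) (suc k) ne = tPower-off b k (λ e → ne (cong suc e))

  monomial-diag : ∀ a b → monomial a b a b ≡ + 1
  monomial-diag zero b = tPower-diag b
  monomial-diag (suc a) b = monomial-diag a b

  monomial-off : ∀ a b n k → (n ≢ a ⊎ k ≢ b) → monomial a b n k ≡ + 0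
  monomial-off zero b zero k (inj₁ ne) = ⊥-elim (ne refl)
  monomial-off zero b zero k (inj₂ ne) = tPower-off b k ne
  monomial-off zero b (suc n) k _ = refl
  monomial-off (suc a) b zero k _ = refl
  monomial-off (suc a) b (suc n) k (inj₁ ne) = monomial-off a b n k (inj₁ (λ e → ne (cong suc e)))
  monomial-off (suc a) b (suc n) k (inj₂ ne) = monomial-off a b n k (inj₂ ne)

  mono≈monomial : ∀ a b → mono a b ≈ monomial a b
  mono≈monomial a b n k with n ℕ.≟ a | k ℕ.≟ b
  ... | yes refl | yes refl = Eq.sym (monomial-diag a b)
  ... | no ne | _ = Eq.sym (monomial-off a b n k (inj₁ ne))
  ... | yes _ | no ne = Eq.sym (monomial-off a b n k (inj₂ ne))

  X*≈shift : ∀ U → X * U ≈ Ztx.shift U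
  X*≈shift U = Ztx.≋-trans (Ztx.conv-shift Ztx.1ˢ U) (Ztx.shift-cong (Ztx.conv-identityˡ U))

  T*-coefficient : ∀ U n → (T * U) n Zt.≋ Zt.shift (U n)
  T*-coefficient U n = Zt.≋-trans (Ztx.conv-const (Zt.shift Zt.1ˢ) U n)
    (Zt.≋-trans (Zt.conv-shift Zt.1ˢ (U n)) (Zt.shift-cong (Zt.conv-identityˡ (U n))))

  X-cancel : ∀ Z → X * Z ≈ 0# → Z ≈ 0#
  X-cancel Z e n k = Eq.trans (Eq.sym (X*≈shift Z (suc n) k)) (e (suc n) k)

  mono-1 : mono 0 0 ≈ 1#
  mono-1 = mono≈monomial 0 0

  mono-t : mono 0 1 ≈ T
  mono-t = mono≈monomial 0 1

  mono-x* : ∀ a b → mono (suc a) b ≈ X * mono a b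
  mono-x* a b = trans (mono≈monomial (suc a) b)
    (sym (trans (X*≈shift (mono a b)) (Ztx.shift-cong (mono≈monomial a b))))

  mono-x : mono 1 0 ≈ X
  mono-x = begin
    mono 1 0     ≈⟨ mono-x* 0 0 ⟩
    X * mono 0 0 ≈⟨ *-congˡ {X} mono-1 ⟩
    X * 1#       ≈⟨ *-identityʳ X ⟩
    X            ∎

  mono-xt : mono 1 1 ≈ X * T
  mono-xt = trans (mono-x* 0 1) (*-congˡ {X} mono-t)

  mono-xx : mono 2 0 ≈ X * X
  mono-xx = trans (mono-x* 1 0) (*-congˡ {X} mono-x)

  mono-xxt : mono 2 1 ≈ X * X * T
  mono-xxt = begin
    mono 2 1      ≈⟨ mono-x* 1 1 ⟩
    X * mono 1 1  ≈⟨ *-congˡ {X} mono-xt ⟩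
    X * (X * T)   ≈⟨ sym (*-assoc X X T) ⟩
    X * X * T     ∎

  mono-xxx : mono 3 0 ≈ X * X * X
  mono-xxx = begin
    mono 3 0      ≈⟨ mono-x* 2 0 ⟩
    X * mono 2 0  ≈⟨ *-congˡ {X} mono-xx ⟩
    X * (X * X)   ≈⟨ sym (*-assoc X X X) ⟩
    X * X * X     ∎

  mono-xxxt : mono 3 1 ≈ X * X * X * T
  mono-xxxt = begin
    mono 3 1          ≈⟨ mono-x* 2 1 ⟩
    X * mono 2 1      ≈⟨ *-congˡ {X} mono-xxt ⟩
    X * (X * X * T)   ≈⟨ sym (*-assoc X (X * X) T) ⟩
    X * (X * X) * T   ≈⟨ *-congʳ {T} (sym (*-assoc X X X)) ⟩
    X * X * X * T     ∎


-- Each exhibits the defect of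
-- a target equation as an explicit combination of the defects of given
-- equations, so the target follows once the given equations hold.
module Elimination where

  open import Data.Integer using (+_)
  open Bivariate
  open CommutativeRing SerRing
  open import Algebra.Properties.Group +-group using (x∙y⁻¹≈ε⇒x≈y; x≈y⇒x∙y⁻¹≈ε)
  open import Relation.Binary.Reasoning.Setoid setoid
  open Solver using (solve; _:=_; _:+_; _:*_; _:-_; con)

  *-vanishes : ∀ a e → e ≈ 0# → a * e ≈ 0#
  *-vanishes a e p = trans (*-congˡ {a} p) (zeroʳ a)

  +-vanishes : ∀ e f → e ≈ 0# → f ≈ 0# → e + f ≈ 0#
  +-vanishes e f p q = trans (+-cong p q) (+-identityʳ 0#)

  solveForF-certificate : ∀ (X T F A A' B G : Carrier) →
    let Q = F + (T - 1#) * B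
        L = 1# - X * X * G
        D = 1# - X * X - X * T - X * X * G
        e₆ = F - (1# + X * A * Q)
        e₁ = A - (1# + X + X * A * (X * G))
        e₂ = A' - X * (1# + A') * (X * G)
        e₄ = B - (X * (Q - 1#) + X * A' * Q)
    in F * D - (1# - X * T - X * X * G + X - X * X * T + X * X - X * X * X * T + X * X * X)
       ≈ D * e₆ + X * A * (L * e₆ + X * Q * e₁ + (T - 1#) * (L * e₄ + X * Q * e₂)) + X * (1# + X - T * X) * e₁
  solveForF-certificate = solve 7 (λ X T F A A' B G →
    let one = con (+ 1)
        Q = F :+ (T :- one) :* B
        L = one :- X :* X :* G
        D = one :- X :* X :- X :* T :- X :* X :* G
        e₆ = F :- (one :+ X :* A :* Q)
        e₁ = A :- (one :+ X :+ X :* A :* (X :* G))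
        e₂ = A' :- X :* (one :+ A') :* (X :* G)
        e₄ = B :- (X :* (Q :- one) :+ X :* A' :* Q)
    in F :* D :- (one :- X :* T :- X :* X :* G :+ X :- X :* X :* T :+ X :* X :- X :* X :* X :* T :+ X :* X :* X)
       := D :* e₆ :+ X :* A :* (L :* e₆ :+ X :* Q :* e₁ :+ (T :- one) :* (L :* e₄ :+ X :* Q :* e₂))
          :+ X :* (one :+ X :- T :* X) :* e₁) refl

  solveForF : ∀ (X T F A A' B G : Carrier) →
    let Q = F + (T - 1#) * B in
    F ≈ 1# + X * A * Q →
    A ≈ 1# + X + X * A * (X * G) →
    A' ≈ X * (1# + A') * (X * G) →
    B ≈ X * (Q - 1#) + X * A' * Q →
    F * (1# - X * X - X * T - X * X * G) ≈ 1# - X * T - X * X * G + X - X * X * T + X * X - X * X * X * T + X * X * X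
  solveForF X T F A A' B G h₆ h₁ h₂ h₄ = x∙y⁻¹≈ε⇒x≈y _ _ (begin
    F * D - N ≈⟨ solveForF-certificate X T F A A' B G ⟩
    D * e₆ + X * A * (L * e₆ + X * Q * e₁ + (T - 1#) * (L * e₄ + X * Q * e₂)) + X * (1# + X - T * X) * e₁
      ≈⟨ +-vanishes _ _
           (+-vanishes _ _ (*-vanishes D e₆ z₆)
              (*-vanishes (X * A) _ (+-vanishes _ _ (+-vanishes _ _ (*-vanishes L e₆ z₆) (*-vanishes (X * Q) e₁ z₁))
                 (*-vanishes (T - 1#) _ (+-vanishes _ _ (*-vanishes L e₄ z₄) (*-vanishes (X * Q) e₂ z₂))))))
           (*-vanishes (X * (1# + X - T * X)) e₁ z₁) ⟩
    0#        ∎)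
    where
    Q L D N e₆ e₁ e₂ e₄ : Carrier
    Q = F + (T - 1#) * B
    L = 1# - X * X * G
    D = 1# - X * X - X * T - X * X * G
    N = 1# - X * T - X * X * G + X - X * X * T + X * X - X * X * X * T + X * X * X
    e₆ = F - (1# + X * A * Q)
    e₁ = A - (1# + X + X * A * (X * G))
    e₂ = A' - X * (1# + A') * (X * G)
    e₄ = B - (X * (Q - 1#) + X * A' * Q)
    z₆ : e₆ ≈ 0#
    z₆ = x≈y⇒x∙y⁻¹≈ε h₆
    z₁ : e₁ ≈ 0#
    z₁ = x≈y⇒x∙y⁻¹≈ε h₁
    z₂ : e₂ ≈ 0#
    z₂ = x≈y⇒x∙y⁻¹≈ε h₂
    z₄ : e₄ ≈ 0#
    z₄ = x≈y⇒x∙y⁻¹≈ε h₄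

  quadratic-certificate : ∀ (X T A A' H : Carrier) →
    let P = A + (T - 1#) * A'
        L = 1# - X * X * H
        e₁ = A - (1# + X + X * A * (P - 1#))
        e₂ = A' - X * (1# + A') * (P - 1#)
        eₚ = P - (1# + X * H)
    in X * (H - (1# + X * T * H + X * X * (H * H))) ≈ e₁ + X * A * eₚ + (T - 1#) * (e₂ + X * (1# + A') * eₚ) - L * eₚ
  quadratic-certificate = solve 5 (λ X T A A' H →
    let one = con (+ 1)
        P = A :+ (T :- one) :* A'
        L = one :- X :* X :* H
        e₁ = A :- (one :+ X :+ X :* A :* (P :- one))
        e₂ = A' :- X :* (one :+ A') :* (P :- one)
        eₚ = P :- (one :+ X :* H)
    in X :* (H :- (one :+ X :* T :* H :+ X :* X :* (H :* H)))
       := e₁ :+ X :* A :* eₚ :+ (T :- one) :* (e₂ :+ X :* (one :+ A') :* eₚ) :- L :* eₚ) refl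

  quadratic : ∀ (X T A A' H : Carrier) →
    let P = A + (T - 1#) * A' in
    A ≈ 1# + X + X * A * (P - 1#) →
    A' ≈ X * (1# + A') * (P - 1#) →
    P ≈ 1# + X * H →
    X * (H - (1# + X * T * H + X * X * (H * H))) ≈ 0#
  quadratic X T A A' H h₁ h₂ hₚ = begin
    X * (H - (1# + X * T * H + X * X * (H * H)))
      ≈⟨ quadratic-certificate X T A A' H ⟩
    e₁ + X * A * eₚ + (T - 1#) * (e₂ + X * (1# + A') * eₚ) - L * eₚ
      ≈⟨ +-cong (+-vanishes _ _ (+-vanishes _ _ z₁ (*-vanishes (X * A) eₚ zₚ))
                   (*-vanishes (T - 1#) _ (+-vanishes _ _ z₂ (*-vanishes (X * (1# + A')) eₚ zₚ))))
                (-‿cong (*-vanishes L eₚ zₚ)) ⟩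
    0# - 0#
      ≈⟨ -‿inverseʳ 0# ⟩
    0# ∎
    where
    P L e₁ e₂ eₚ : Carrier
    P = A + (T - 1#) * A'
    L = 1# - X * X * H
    e₁ = A - (1# + X + X * A * (P - 1#))
    e₂ = A' - X * (1# + A') * (P - 1#)
    eₚ = P - (1# + X * H)
    z₁ : e₁ ≈ 0#
    z₁ = x≈y⇒x∙y⁻¹≈ε h₁
    z₂ : e₂ ≈ 0#
    z₂ = x≈y⇒x∙y⁻¹≈ε h₂
    zₚ : eₚ ≈ 0#
    zₚ = x≈y⇒x∙y⁻¹≈ε hₚ


-- The equation W = 1 + xtW + x²W² of G has at most one solution: the
-- coefficient of xⁿ⁺¹ on the right only involves coefficients of xⁱ, i ≤ n.
module UniqueSolution where

  open import Data.Nat as ℕ using (zero; suc; _≤_; z≤n; s≤s)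
  open import Data.Nat.Properties using (≤-refl; ≤-trans; m≤n⇒m≤1+n)
  import Data.Integer as ℤ
  import Data.Integer.Properties as ℤP
  open import Relation.Binary.PropositionalEquality as Eq using (_≡_; refl; cong₂)
  open Bivariate
  open Monomials
  open CommutativeRing SerRing hiding (refl; zero)

  Φ : Ser → Ser
  Φ W = 1# + X * T * W + X * X * (W * W)

  Φ-zero : ∀ W k → Φ W 0 k ≡ Zt.1ˢ k
  Φ-zero W k = Eq.trans
    (cong₂ (λ u v → Zt.1ˢ k ℤ.+ u ℤ.+ v)
      (Eq.trans (*-assoc X T W 0 k) (X*≈shift (T * W) 0 k))
      (Eq.trans (*-assoc X X (W * W) 0 k) (X*≈shift (X * (W * W)) 0 k)))
    (Eq.trans (ℤP.+-identityʳ _) (ℤP.+-identityʳ _))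

  Φ-suc : ∀ n W W' → (∀ i → i ≤ n → ∀ k → W i k ≡ W' i k) → ∀ k → Φ W (suc n) k ≡ Φ W' (suc n) k
  Φ-suc n W W' e k = cong₂ (λ u v → Ztx.1ˢ (suc n) k ℤ.+ u ℤ.+ v) linear quadratic
    where
    linear-coefficient : ∀ V → (X * T * V) (suc n) k ≡ Zt.shift (V n) k
    linear-coefficient V = Eq.trans (*-assoc X T V (suc n) k)
      (Eq.trans (X*≈shift (T * V) (suc n) k) (T*-coefficient V n k))
    linear : (X * T * W) (suc n) k ≡ (X * T * W') (suc n) k
    linear = Eq.trans (linear-coefficient W)
      (Eq.trans (Zt.shift-cong (e n ≤-refl) k) (Eq.sym (linear-coefficient W')))
    quadratic-coefficient : ∀ V → (X * X * (V * V)) (suc n) k ≡ Ztx.shift (V * V) n k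
    quadratic-coefficient V = Eq.trans (*-assoc X X (V * V) (suc n) k)
      (Eq.trans (X*≈shift (X * (V * V)) (suc n) k) (X*≈shift (V * V) n k))
    square : ∀ m → (∀ i → i ≤ m → ∀ k → W i k ≡ W' i k) → Ztx.shift (W * W) m k ≡ Ztx.shift (W' * W') m k
    square zero _ = refl
    square (suc m) e' = Ztx.conv-cong≤ m (λ i p → e' i (m≤n⇒m≤1+n p)) (λ i p → e' i (m≤n⇒m≤1+n p)) k
    quadratic : (X * X * (W * W)) (suc n) k ≡ (X * X * (W' * W')) (suc n) k
    quadratic = Eq.trans (quadratic-coefficient W)
      (Eq.trans (square n e) (Eq.sym (quadratic-coefficient W')))

  Φ-unique : ∀ W W' → W ≈ Φ W → W' ≈ Φ W' → W ≈ W'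
  Φ-unique W W' hW hW' n k = agree n n ≤-refl k
    where
    agree : ∀ n i → i ≤ n → ∀ k → W i k ≡ W' i k
    agree zero zero z≤n k = Eq.trans (hW 0 k) (Eq.trans (Φ-zero W k) (Eq.sym (Eq.trans (hW' 0 k) (Φ-zero W' k))))
    agree (suc n) zero z≤n k = agree n zero z≤n k
    agree (suc n) (suc i) (s≤s p) k = Eq.trans (hW (suc i) k)
      (Eq.trans (Φ-suc i W W' (λ j q → agree n j (≤-trans q p)) k) (Eq.sym (hW' (suc i) k)))


module Patterns where

  open import Data.Nat as ℕ using (ℕ; _+_; _<_; _<?_)
  open import Data.Nat.Properties as NP using (+-cancelˡ-<; +-monoʳ-<; <⇒≯)
  open import Data.List as L using (List; []; _∷_; _++_; map; null)
  open import Data.Bool using (Bool; true; false; _∧_; if_then_else_; not)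
  open import Data.Product using (∃; _×_; _,_)
  open import Data.Sum using (_⊎_; inj₁; inj₂)
  open import Data.Empty using (⊥; ⊥-elim)
  open import Relation.Nullary using (¬_; yes; no)
  open import Relation.Nullary.Decidable using (⌊_⌋)
  open import Relation.Binary.PropositionalEquality as Eq using (_≡_; refl; cong; cong₂; sym; trans)
  open import Data.List.Relation.Unary.All as All using (All; []; _∷_)
  open import Data.List.Relation.Binary.Sublist.Propositional as SL using (_⊆_; []; _∷ʳ_; _∷_)
  import Data.List.Relation.Binary.Sublist.Propositional.Properties as SublistProperties

  -- boolean comparison, so that statistics are computed by evaluation
  lt : ℕ → ℕ → Bool
  lt a b = ⌊ a <? b ⌋

  lt-true : ∀ {a b} → a < b → lt a b ≡ true
  lt-true {a} {b} p with a <? b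
  ... | yes _ = refl
  ... | no q = ⊥-elim (q p)

  lt-false : ∀ {a b} → ¬ a < b → lt a b ≡ false
  lt-false {a} {b} p with a <? b
  ... | yes q = ⊥-elim (p q)
  ... | no _ = refl

  lt-sound : ∀ {a b} → lt a b ≡ true → a < b
  lt-sound {a} {b} p with a <? b
  ... | yes q = q
  lt-sound {a} {b} () | no _

  lt-shift : ∀ r a b → lt (r + a) (r + b) ≡ lt a b
  lt-shift r a b with a <? b
  ... | yes p = lt-true (+-monoʳ-< r p)
  ... | no p = lt-false (λ q → p (+-cancelˡ-< r a b q))

  startsDesc : List ℕ → Bool
  startsDesc (a ∷ b ∷ _) = lt b a
  startsDesc _ = false

  endsAsc : List ℕ → Bool
  endsAsc (a ∷ b ∷ []) = lt a b
  endsAsc (a ∷ b ∷ c ∷ r) = endsAsc (b ∷ c ∷ r)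
  endsAsc _ = false

  Asc3 : List ℕ → Set
  Asc3 (a ∷ b ∷ c ∷ r) = (a < b × b < c) ⊎ Asc3 (b ∷ c ∷ r)
  Asc3 _ = ⊥

  Asc3-++ˡ : ∀ pre σ → Asc3 σ → Asc3 (pre ++ σ)
  Asc3-++ˡ [] σ c = c
  Asc3-++ˡ (x ∷ []) (a ∷ b ∷ c ∷ r) p = inj₂ p
  Asc3-++ˡ (x ∷ y ∷ pre) σ p with Asc3-++ˡ (y ∷ pre) σ p
  ... | q with pre | σ
  ... | [] | a ∷ b ∷ r = inj₂ q
  ... | z ∷ pre' | _ = inj₂ q

  contains123c⇒Asc3 : ∀ σ → Contains123c σ → Asc3 σ
  contains123c⇒Asc3 σ (pre , a , b , c , post , refl , p , q) = Asc3-++ˡ pre (a ∷ b ∷ c ∷ post) (inj₁ (p , q))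

  Asc3⇒contains123c : ∀ σ → Asc3 σ → Contains123c σ
  Asc3⇒contains123c (a ∷ b ∷ c ∷ r) (inj₁ (p , q)) = [] , a , b , c , r , refl , p , q
  Asc3⇒contains123c (a ∷ b ∷ c ∷ r) (inj₂ x) with Asc3⇒contains123c (b ∷ c ∷ r) x
  ... | pre , a' , b' , c' , post , e , p , q = a ∷ pre , a' , b' , c' , post , cong (a ∷_) e , p , q

  raise : ℕ → List ℕ → List ℕ
  raise r = map (r +_)

  endsAsc-raise : ∀ r α → endsAsc (raise r α) ≡ endsAsc α
  endsAsc-raise r [] = refl
  endsAsc-raise r (a ∷ []) = refl
  endsAsc-raise r (a ∷ b ∷ []) = lt-shift r a b
  endsAsc-raise r (a ∷ b ∷ c ∷ α) = endsAsc-raise r (b ∷ c ∷ α)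

  occ321-raise : ∀ r α → occ321 (raise r α) ≡ occ321 α
  occ321-raise r [] = refl
  occ321-raise r (a ∷ []) = refl
  occ321-raise r (a ∷ b ∷ []) = refl
  occ321-raise r (a ∷ b ∷ c ∷ α) = cong₂ (λ u v → (if u then 1 else 0) + v) (cong₂ _∧_ (lt-shift r b a) (lt-shift r c b)) (occ321-raise r (b ∷ c ∷ α))

  Asc3-raise⁻ : ∀ r α → Asc3 (raise r α) → Asc3 α
  Asc3-raise⁻ r (a ∷ b ∷ c ∷ α) (inj₁ (p , q)) = inj₁ (+-cancelˡ-< r a b p , +-cancelˡ-< r b c q)
  Asc3-raise⁻ r (a ∷ b ∷ c ∷ α) (inj₂ x) = inj₂ (Asc3-raise⁻ r (b ∷ c ∷ α) x)

  Asc3-raise⁺ : ∀ r α → Asc3 α → Asc3 (raise r α)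
  Asc3-raise⁺ r (a ∷ b ∷ c ∷ α) (inj₁ (p , q)) = inj₁ (+-monoʳ-< r p , +-monoʳ-< r q)
  Asc3-raise⁺ r (a ∷ b ∷ c ∷ α) (inj₂ x) = inj₂ (Asc3-raise⁺ r (b ∷ c ∷ α) x)

  ⊆-map⁻ : ∀ (f : ℕ → ℕ) zs ys → zs ⊆ map f ys → ∃ λ ws → ws ⊆ ys × zs ≡ map f ws
  ⊆-map⁻ f [] [] [] = [] , [] , refl
  ⊆-map⁻ f zs (y ∷ ys) (_ ∷ʳ p) with ⊆-map⁻ f zs ys p
  ... | ws , q , e = ws , y ∷ʳ q , e
  ⊆-map⁻ f (z ∷ zs) (y ∷ ys) (refl ∷ p) with ⊆-map⁻ f zs ys p
  ... | ws , q , e = y ∷ ws , refl ∷ q , cong (f y ∷_) e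

  contains132-raise⁻ : ∀ r α → Contains132 (raise r α) → Contains132 α
  contains132-raise⁻ r α (a , b , c , s , p , q) with ⊆-map⁻ (r +_) (a ∷ b ∷ c ∷ []) α s
  ... | a' ∷ b' ∷ c' ∷ [] , s' , refl = a' , b' , c' , s' , +-cancelˡ-< r a' c' p , +-cancelˡ-< r c' b' q

  contains132-raise⁺ : ∀ r α → Contains132 α → Contains132 (raise r α)
  contains132-raise⁺ r α (a , b , c , s , p , q) = r + a , r + b , r + c , SublistProperties.map⁺ (r +_) s , +-monoʳ-< r p , +-monoʳ-< r q

  -- the 321-contribution of the window (M, β₁, β₂) when M exceeds all of β
  startWeight : List ℕ → ℕ
  startWeight ys = if startsDesc ys then 1 else 0

  -- if every entry of xs is below M, no 321-window straddles xs and M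
  occ321-below-max : ∀ M xs ys → All (_< M) xs → occ321 (xs ++ M ∷ ys) ≡ occ321 xs + occ321 (M ∷ ys)
  occ321-below-max M [] ys _ = refl
  occ321-below-max M (x ∷ []) [] _ = refl
  occ321-below-max M (x ∷ []) (y ∷ ys) (px ∷ []) rewrite lt-false (<⇒≯ px) = refl
  occ321-below-max M (x ∷ x' ∷ []) [] (px ∷ px' ∷ []) rewrite lt-false (<⇒≯ px') with lt x' x
  ... | true = refl
  ... | false = refl
  occ321-below-max M (x ∷ x' ∷ []) (y ∷ ys) (px ∷ px' ∷ []) rewrite lt-false (<⇒≯ px') with lt x' x
  ... | true = refl
  ... | false = refl
  occ321-below-max M (x ∷ x' ∷ x'' ∷ r) ys (px ∷ ax) rewrite occ321-below-max M (x' ∷ x'' ∷ r) ys ax =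
    sym (NP.+-assoc (if lt x' x ∧ lt x'' x' then 1 else 0) (occ321 (x' ∷ x'' ∷ r)) (occ321 (M ∷ ys)))

  occ321-max-head : ∀ M ys → All (_< M) ys → occ321 (M ∷ ys) ≡ startWeight ys + occ321 ys
  occ321-max-head M [] _ = refl
  occ321-max-head M (y ∷ []) _ = refl
  occ321-max-head M (y ∷ y' ∷ r) (py ∷ _) rewrite lt-true py with lt y' y
  ... | true = refl
  ... | false = refl

  startsDesc-max-head : ∀ M ys → All (_< M) ys → startsDesc (M ∷ ys) ≡ not (null ys)
  startsDesc-max-head M [] _ = refl
  startsDesc-max-head M (y ∷ ys) (py ∷ _) = lt-true py

  startsDesc-before-max : ∀ M x ys → x < M → startsDesc (x ∷ M ∷ ys) ≡ false
  startsDesc-before-max M x ys p = lt-false (<⇒≯ p)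

  endsAsc-++ : ∀ zs w w' ws → endsAsc (zs ++ w ∷ w' ∷ ws) ≡ endsAsc (w ∷ w' ∷ ws)
  endsAsc-++ [] w w' ws = refl
  endsAsc-++ (z ∷ []) w w' ws = refl
  endsAsc-++ (z ∷ z' ∷ []) w w' ws = refl
  endsAsc-++ (z ∷ z' ∷ z'' ∷ zs) w w' ws = endsAsc-++ (z' ∷ z'' ∷ zs) w w' ws

  endsAsc-max-last : ∀ M xs → All (_< M) xs → endsAsc (xs ++ M ∷ []) ≡ not (null xs)
  endsAsc-max-last M [] _ = refl
  endsAsc-max-last M (x ∷ []) (px ∷ []) = lt-true px
  endsAsc-max-last M (x ∷ x' ∷ []) (_ ∷ px ∷ []) = lt-true px
  endsAsc-max-last M (x ∷ x' ∷ x'' ∷ r) (_ ∷ ax) = endsAsc-max-last M (x' ∷ x'' ∷ r) ax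

  endsAsc-max-one : ∀ M xs y → y < M → endsAsc (xs ++ M ∷ y ∷ []) ≡ false
  endsAsc-max-one M xs y p = trans (endsAsc-++ xs M y []) (lt-false (<⇒≯ p))

  endsAsc-max-two : ∀ M xs y y' r → endsAsc (xs ++ M ∷ y ∷ y' ∷ r) ≡ endsAsc (y ∷ y' ∷ r)
  endsAsc-max-two M xs y y' r = endsAsc-++ xs M y (y' ∷ r)

  -- a consecutive 123 in xs ++ M ∷ ys lies in xs, ends xs ascending into M,
  -- or lies in ys (no window containing M can be increasing past M)
  Asc3-around-max : ∀ M xs ys → All (_< M) xs → All (_< M) ys → Asc3 (xs ++ M ∷ ys) → Asc3 xs ⊎ (endsAsc xs ≡ true ⊎ Asc3 ys)
  Asc3-around-max M [] (y ∷ y' ∷ r) _ (py ∷ _) (inj₁ (p , _)) = ⊥-elim (<⇒≯ py p)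
  Asc3-around-max M [] (y ∷ y' ∷ r) _ _ (inj₂ c) = inj₂ (inj₂ c)
  Asc3-around-max M (x ∷ []) (y ∷ r) _ (py ∷ _) (inj₁ (_ , p)) = ⊥-elim (<⇒≯ py p)
  Asc3-around-max M (x ∷ []) (y ∷ r) _ ay (inj₂ c) with Asc3-around-max M [] (y ∷ r) [] ay c
  ... | inj₂ (inj₂ c') = inj₂ (inj₂ c')
  Asc3-around-max M (x ∷ x' ∷ []) ys _ ay (inj₁ (p , _)) = inj₂ (inj₁ (lt-true p))
  Asc3-around-max M (x ∷ x' ∷ []) ys (_ ∷ ax) ay (inj₂ c) with Asc3-around-max M (x' ∷ []) ys ax ay c
  ... | inj₂ (inj₂ c') = inj₂ (inj₂ c')
  Asc3-around-max M (x ∷ x' ∷ x'' ∷ r) ys _ ay (inj₁ p) = inj₁ (inj₁ p)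
  Asc3-around-max M (x ∷ x' ∷ x'' ∷ r) ys (_ ∷ ax) ay (inj₂ c) with Asc3-around-max M (x' ∷ x'' ∷ r) ys ax ay c
  ... | inj₁ c' = inj₁ (inj₂ c')
  ... | inj₂ (inj₁ e) = inj₂ (inj₁ e)
  ... | inj₂ (inj₂ c') = inj₂ (inj₂ c')

  Asc3-++ʳ : ∀ xs zs → Asc3 xs → Asc3 (xs ++ zs)
  Asc3-++ʳ (a ∷ b ∷ c ∷ r) zs (inj₁ p) = inj₁ p
  Asc3-++ʳ (a ∷ b ∷ c ∷ r) zs (inj₂ q) = inj₂ (Asc3-++ʳ (b ∷ c ∷ r) zs q)

  endsAsc⇒Asc3 : ∀ M xs zs → All (_< M) xs → endsAsc xs ≡ true → Asc3 (xs ++ M ∷ zs)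
  endsAsc⇒Asc3 M (x ∷ x' ∷ []) zs (_ ∷ px' ∷ []) e = inj₁ (lt-sound e , px')
  endsAsc⇒Asc3 M (x ∷ x' ∷ x'' ∷ r) zs (_ ∷ ax) e = inj₂ (endsAsc⇒Asc3 M (x' ∷ x'' ∷ r) zs ax e)


module Joining where

  open Patterns
  open import Data.Nat as ℕ using (ℕ; zero; suc; _+_; _∸_; _<_; _≤_)
  open import Data.Nat.Properties as NP using (<-asym; <-trans)
  open import Data.List as L using (List; []; _∷_; _++_; map; upTo; applyUpTo)
  import Data.List.Properties as LP
  open import Data.Product using (_,_)
  open import Data.Sum using (_⊎_; inj₁; inj₂)
  open import Data.Empty using (⊥; ⊥-elim)
  open import Data.Bool using (true; false)
  open import Relation.Nullary using (¬_)
  open import Relation.Binary.PropositionalEquality as Eq using (_≡_; _≢_; refl; cong; cong₂; sym; trans; subst)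
  open import Data.List.Relation.Unary.All as All using (All; []; _∷_)
  open import Data.List.Relation.Unary.Any using (here; there)
  open import Data.List.Membership.Propositional using (_∈_)
  open import Data.List.Relation.Binary.Sublist.Propositional as SL using (_⊆_; []; _∷ʳ_; _∷_)
  open import Data.List.Relation.Binary.Permutation.Propositional using (_↭_; ↭-trans; ↭-refl; prep)
  import Data.List.Relation.Binary.Permutation.Propositional.Properties as PP

  []⊆ : ∀ (l : List ℕ) → [] ⊆ l
  []⊆ [] = []
  []⊆ (x ∷ l) = x ∷ʳ []⊆ l

  [x]⊆⇒∈ : ∀ {c : ℕ} {l} → (c ∷ []) ⊆ l → c ∈ l
  [x]⊆⇒∈ (y ∷ʳ p) = there ([x]⊆⇒∈ p)
  [x]⊆⇒∈ (refl ∷ p) = here refl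

  ∷⊆⇒⊆ : ∀ {b : ℕ} {cs l} → (b ∷ cs) ⊆ l → cs ⊆ l
  ∷⊆⇒⊆ (y ∷ʳ p) = y ∷ʳ ∷⊆⇒⊆ p
  ∷⊆⇒⊆ (refl ∷ p) = _ ∷ʳ p

  singleton-around-max : ∀ {c M : ℕ} {ys} zs → (c ∷ []) ⊆ zs ++ M ∷ ys → c ≢ M → ((c ∷ []) ⊆ zs) ⊎ (c ∈ ys)
  singleton-around-max [] (_ ∷ʳ p) ne = inj₂ ([x]⊆⇒∈ p)
  singleton-around-max [] (refl ∷ p) ne = ⊥-elim (ne refl)
  singleton-around-max (z ∷ zs) (_ ∷ʳ p) ne with singleton-around-max zs p ne
  ... | inj₁ q = inj₁ (z ∷ʳ q)
  ... | inj₂ q = inj₂ q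
  singleton-around-max (z ∷ zs) (refl ∷ p) ne = inj₁ (refl ∷ []⊆ zs)

  pair-around-max : ∀ {b c M : ℕ} {ys} zs → (b ∷ c ∷ []) ⊆ zs ++ M ∷ ys → c < b → All (_< M) zs → ((b ∷ c ∷ []) ⊆ zs) ⊎ (c ∈ ys)
  pair-around-max [] (_ ∷ʳ p) q _ = inj₂ ([x]⊆⇒∈ (∷⊆⇒⊆ p))
  pair-around-max [] (refl ∷ p) q _ = inj₂ ([x]⊆⇒∈ p)
  pair-around-max (z ∷ zs) (_ ∷ʳ p) q (_ ∷ az) with pair-around-max zs p q az
  ... | inj₁ r = inj₁ (z ∷ʳ r)
  ... | inj₂ r = inj₂ r
  pair-around-max {b} {c} {M} (z ∷ zs) (refl ∷ p) q (pz ∷ _) with singleton-around-max zs p (λ e → NP.<-irrefl e (<-trans q pz))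
  ... | inj₁ r = inj₁ (refl ∷ r)
  ... | inj₂ r = inj₂ r

  avoids132-tail : ∀ x xs → ¬ Contains132 (x ∷ xs) → ¬ Contains132 xs
  avoids132-tail x xs n (a , b , c , s , p , q) = n (a , b , c , x ∷ʳ s , p , q)

  -- if all of xs lie above all of ys and both avoid 132, so does xs ++ M ∷ ys
  -- (M above everything): a 132 would need its 1 before M and its 2 after
  avoids132-join : ∀ M xs ys → All (λ x → All (_< x) ys) xs → All (_< M) xs → All (_< M) ys →
       ¬ Contains132 xs → ¬ Contains132 ys → ¬ Contains132 (xs ++ M ∷ ys)
  avoids132-join M [] ys _ _ ay n1 n2 (a , b , c , _ ∷ʳ s , p , q) = n2 (a , b , c , s , p , q)
  avoids132-join M [] ys _ _ ay n1 n2 (a , b , c , refl ∷ s , p , q) = <-asym p (All.lookup ay ([x]⊆⇒∈ (∷⊆⇒⊆ s)))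
  avoids132-join M (x ∷ xs) ys (_ ∷ axs) (_ ∷ pxs) ay n1 n2 (a , b , c , _ ∷ʳ s , p , q) =
    avoids132-join M xs ys axs pxs ay (avoids132-tail x xs n1) n2 (a , b , c , s , p , q)
  avoids132-join M (x ∷ xs) ys (ax ∷ axs) (_ ∷ pxs) ay n1 n2 (a , b , c , refl ∷ s , p , q) with pair-around-max xs s q pxs
  ... | inj₁ t = n1 (x , b , c , refl ∷ t , p , q)
  ... | inj₂ t = <-asym p (All.lookup ax t)

  open import Function using (_∘_; id)
  open import Data.List.Membership.Propositional.Properties using (∈-upTo⁻)

  applyUpTo-+ : ∀ (f : ℕ → ℕ) r m → applyUpTo f (r + m) ≡ applyUpTo f r ++ applyUpTo (λ i → f (r + i)) m
  applyUpTo-+ f zero m = refl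
  applyUpTo-+ f (suc r) m = cong (f 0 ∷_) (applyUpTo-+ (f ∘ suc) r m)

  upTo-split : ∀ r m → upTo (r + m) ≡ upTo r ++ raise r (upTo m)
  upTo-split r m = trans (applyUpTo-+ id r m) (cong (upTo r ++_) (sym (LP.map-applyUpTo id (r +_) m)))

  join-isPerm : ∀ r m α β → α ↭ upTo m → β ↭ upTo r → raise r α ++ (r + m) ∷ β ↭ upTo (suc (r + m))
  join-isPerm r m α β pα pβ =
    ↭-trans (PP.++⁺ (PP.map⁺ (r +_) pα) (prep (r + m) pβ))
    (↭-trans (PP.shift (r + m) (raise r (upTo m)) (upTo r))
    (↭-trans (prep (r + m) (PP.++-comm (raise r (upTo m)) (upTo r)))
    (↭-trans (PP.∷↭∷ʳ (r + m) (upTo r ++ raise r (upTo m)))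
      (Eq.subst (λ z → (upTo r ++ raise r (upTo m)) L.∷ʳ (r + m) ↭ z)
          (trans (cong (L._∷ʳ (r + m)) (sym (upTo-split r m))) (LP.upTo-∷ʳ (r + m))) ↭-refl))))

  perm-bounded : ∀ {n σ} → σ ↭ upTo n → All (_< n) σ
  perm-bounded {n} {σ} p = All.tabulate (λ x∈ → ∈-upTo⁻ (PP.∈-resp-↭ p x∈))

  raise-bounded : ∀ r m α → All (_< m) α → All (_< r + m) (raise r α)
  raise-bounded r m [] [] = []
  raise-bounded r m (a ∷ α) (p ∷ ps) = NP.+-monoʳ-< r p ∷ raise-bounded r m α ps

  raise-≥ : ∀ r α → All (r ≤_) (raise r α)
  raise-≥ r [] = []
  raise-≥ r (a ∷ α) = NP.m≤m+n r a ∷ raise-≥ r α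

  raw-join-InS : ∀ r m α β → InS m α → InS r β → endsAsc α ≡ false → InS (suc (r + m)) (raise r α ++ (r + m) ∷ β)
  raw-join-InS r m α β (pα , n1α , n2α) (pβ , n1β , n2β) eα =
    join-isPerm r m α β pα pβ ,
    avoids132-join (r + m) (raise r α) β
       (All.map (λ {x} rx → All.map (λ {y} y<r → NP.<-≤-trans y<r rx) bβ) (raise-≥ r α))
       (raise-bounded r m α bα)
       (All.map (λ {y} y<r → NP.<-≤-trans y<r (NP.m≤m+n r m)) bβ)
       (λ c → n1α (contains132-raise⁻ r α c)) n1β ,
    λ c → no-Asc3 (Asc3-around-max (r + m) (raise r α) β (raise-bounded r m α bα) (All.map (λ {y} y<r → NP.<-≤-trans y<r (NP.m≤m+n r m)) bβ)
        (contains123c⇒Asc3 _ c))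
    where
    bα : All (_< m) α
    bα = perm-bounded pα
    bβ : All (_< r) β
    bβ = perm-bounded pβ
    no-Asc3 : Asc3 (raise r α) ⊎ (endsAsc (raise r α) ≡ true ⊎ Asc3 β) → ⊥
    no-Asc3 (inj₁ c) = n2α (Asc3⇒contains123c α (Asc3-raise⁻ r α c))
    no-Asc3 (inj₂ (inj₁ e)) with trans (sym (endsAsc-raise r α)) e
    ... | e' rewrite eα with e'
    ... | ()
    no-Asc3 (inj₂ (inj₂ c)) = n2β (Asc3⇒contains123c β c)


  join : ℕ → ℕ → List ℕ → List ℕ → List ℕ
  join n m α β = raise (n ∸ m) α ++ n ∷ β

  join-boundˡ : ∀ {n m α} → m ≤ n → InS m α → All (_< n) (raise (n ∸ m) α)
  join-boundˡ {n} {m} {α} p (pα , _) = subst (λ z → All (_< z) (raise (n ∸ m) α)) (NP.m∸n+n≡m p) (raise-bounded (n ∸ m) m α (perm-bounded pα))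

  join-boundʳ : ∀ {n m β} → InS (n ∸ m) β → All (_< n) β
  join-boundʳ {n} {m} {β} (pβ , _) = All.map (λ {y} y< → NP.<-≤-trans y< (NP.m∸n≤m n m)) (perm-bounded pβ)

  join-InS : ∀ {n m α β} → m ≤ n → InS m α → InS (n ∸ m) β → endsAsc α ≡ false → InS (suc n) (join n m α β)
  join-InS {n} {m} {α} {β} p iα iβ e = subst (λ z → InS (suc z) (raise (n ∸ m) α ++ z ∷ β)) (NP.m∸n+n≡m p) (raw-join-InS (n ∸ m) m α β iα iβ e)

  occ321-join : ∀ {n m α β} → m ≤ n → InS m α → InS (n ∸ m) β → occ321 (join n m α β) ≡ occ321 α + (startWeight β + occ321 β)
  occ321-join {n} {m} {α} {β} p iα iβ = trans (occ321-below-max n (raise (n ∸ m) α) β (join-boundˡ p iα))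
    (cong₂ _+_ (occ321-raise (n ∸ m) α) (occ321-max-head n β (join-boundʳ {n} {m} iβ)))

module DistinctLists where

  open import Data.Nat as ℕ using (ℕ; suc; _<_; _≤_; z≤n; s≤s)
  open import Data.List as L using (List; []; _∷_; _++_; length; upTo)
  open import Data.Product using (_,_)
  open import Data.Sum using (inj₁; inj₂)
  open import Data.Empty using (⊥; ⊥-elim)
  open import Relation.Nullary using (yes; no)
  open import Relation.Binary.PropositionalEquality as Eq using (_≡_; _≢_; refl; cong; sym; trans; subst)
  open import Function.Bundles using (_⇔_; mk⇔)
  open import Data.List.Relation.Unary.All as All using (All; []; _∷_)
  import Data.List.Relation.Unary.All.Properties as AllProperties
  open import Data.List.Relation.Unary.AllPairs using ([]; _∷_)
  open import Data.List.Relation.Unary.Any using (here; there)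
  open import Data.List.Membership.Propositional using (_∈_; _∉_)
  open import Data.List.Membership.Propositional.Properties using (∈-∃++; ∈-++⁻; ∈-++⁺ˡ; ∈-++⁺ʳ; ∈-upTo⁺)
  open import Data.List.Membership.Propositional.Properties.WithK using (unique∧set⇒bag)
  open import Data.List.Relation.Binary.BagAndSetEquality using (∼bag⇒↭)
  open import Data.List.Relation.Unary.Unique.Propositional using (Unique)
  open import Data.List.Relation.Unary.Unique.Propositional.Properties using (upTo⁺)
  open import Data.List.Relation.Binary.Permutation.Propositional using (_↭_; refl; prep; swap; trans)
  import Data.List.Relation.Binary.Permutation.Propositional.Properties as PP
  import Data.List.Properties as LP
  import Data.Nat.Properties as NP

  module _ {A : Set} where

    Unique-resp-↭ : ∀ {xs ys : List A} → xs ↭ ys → Unique xs → Unique ys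
    Unique-resp-↭ refl u = u
    Unique-resp-↭ (prep x p) (a ∷ u) = PP.All-resp-↭ p a ∷ Unique-resp-↭ p u
    Unique-resp-↭ (swap x y p) ((x≢y ∷ ax) ∷ (ay ∷ u)) =
      ((λ e → x≢y (sym e)) ∷ PP.All-resp-↭ p ay) ∷ (PP.All-resp-↭ p ax ∷ Unique-resp-↭ p u)
    Unique-resp-↭ (trans p q) u = Unique-resp-↭ q (Unique-resp-↭ p u)

    same-length : ∀ {xs ys : List A} → Unique xs → Unique ys → (∀ {x} → x ∈ xs ⇔ x ∈ ys) → length xs ≡ length ys
    same-length ux uy e = PP.↭-length (∼bag⇒↭ (unique∧set⇒bag ux uy (λ {x} → e {x})))

    Unique-head : ∀ {x : A} {xs} → Unique (x ∷ xs) → x ∉ xs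
    Unique-head (a ∷ _) x∈ = All.lookup a x∈ refl

    Unique-++-disjoint : ∀ {x : A} xs {ys} → Unique (xs ++ ys) → x ∈ xs → x ∈ ys → ⊥
    Unique-++-disjoint (z ∷ xs) (a ∷ u) (here refl) x∈ys = All.lookup a (∈-++⁺ʳ xs x∈ys) refl
    Unique-++-disjoint (z ∷ xs) (a ∷ u) (there x∈) x∈ys = Unique-++-disjoint xs u x∈ x∈ys

    Unique-++ʳ : ∀ xs {ys : List A} → Unique (xs ++ ys) → Unique ys
    Unique-++ʳ [] u = u
    Unique-++ʳ (x ∷ xs) (_ ∷ u) = Unique-++ʳ xs u

    Unique-++ˡ : ∀ xs {ys : List A} → Unique (xs ++ ys) → Unique xs
    Unique-++ˡ [] u = []
    Unique-++ˡ (x ∷ xs) (a ∷ u) = AllProperties.++⁻ˡ xs a ∷ Unique-++ˡ xs u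

    ∈-remove : ∀ {x a : A} us vs → x ∈ us ++ a ∷ vs → x ≢ a → x ∈ us ++ vs
    ∈-remove {x} {a} us vs x∈ ne with ∈-++⁻ us x∈
    ... | inj₁ p = ∈-++⁺ˡ p
    ... | inj₂ (here e) = ⊥-elim (ne e)
    ... | inj₂ (there p) = ∈-++⁺ʳ us p

    Unique⇒length≤ : ∀ (as bs : List A) → Unique as → (∀ {a} → a ∈ as → a ∈ bs) → length as ≤ length bs
    Unique⇒length≤ [] bs _ _ = z≤n
    Unique⇒length≤ (a ∷ as) bs (na ∷ u) sub with ∈-∃++ (sub (here refl))
    ... | us , vs , refl = subst (suc (length as) ≤_) (sym (LP.length-++-sucʳ us a vs))
      (s≤s (Unique⇒length≤ as (us ++ vs) u (λ {b} b∈ → ∈-remove us vs (sub (there b∈)) (λ e → All.lookup na b∈ (sym e)))))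

  perm-criterion : ∀ (zs : List ℕ) l → Unique zs → All (_< l) zs → length zs ≡ l → zs ↭ upTo l
  perm-criterion zs l u bnd len = ∼bag⇒↭ (unique∧set⇒bag u (upTo⁺ l) (λ {v} → mk⇔ (λ v∈ → ∈-upTo⁺ (All.lookup bnd v∈)) (back v)))
    where
    open import Data.List.Membership.DecPropositional NP._≟_ using (_∈?_)
    back : ∀ v → v ∈ upTo l → v ∈ zs
    back v v∈ with v ∈? zs
    ... | yes p = p
    ... | no np with ∈-∃++ v∈
    ... | us , ws , e = ⊥-elim (NP.<-irrefl refl
        (NP.≤-trans le (NP.≤-reflexive (Eq.trans (cong length (sym e')) (Eq.trans (LP.length-upTo l) (sym len))))))
      where
      e' : upTo l ≡ us ++ v ∷ ws
      e' = e
      sub : ∀ {a} → a ∈ zs → a ∈ us ++ ws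
      sub {a} a∈ = ∈-remove us ws (subst (a ∈_) e' (∈-upTo⁺ (All.lookup bnd a∈))) (λ eq → np (subst (_∈ zs) eq a∈))
      le : suc (length zs) ≤ length (us ++ v ∷ ws)
      le = subst (λ z → suc (length zs) ≤ z) (sym (LP.length-++-sucʳ us v ws)) (s≤s (Unique⇒length≤ zs (us ++ ws) u sub))


-- Every σ ∈ S_{n+1}(132, 123) is a join: writing σ = xs ++ n ∷ ys, avoiding
-- 132 forces every entry of xs above every entry of ys, so ys is a
-- permutation of [0 … r-1] and xs a raised permutation; avoiding consecutive
-- 123 forces xs not to end with an ascent.
module Decomposition where

  open Patterns
  open Joining
  open DistinctLists
  open import Data.Nat as ℕ using (ℕ; suc; _+_; _∸_; _<_; _≤_; s≤s)
  import Data.Nat.Properties as NP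
  open import Data.List as L using (List; []; _∷_; _++_; map; length; upTo)
  import Data.List.Properties as LP
  open import Data.Product using (∃; _×_; _,_)
  open import Data.Sum using (inj₁; inj₂)
  open import Data.Empty using (⊥-elim)
  open import Data.Bool using (true; false)
  open import Relation.Nullary using (¬_)
  open import Relation.Binary.PropositionalEquality as Eq using (_≡_; _≢_; refl; cong; cong₂; sym; trans; subst)
  open import Data.List.Relation.Unary.All as All using (All; []; _∷_)
  open import Data.List.Relation.Unary.Any using (here; there)
  open import Data.List.Membership.Propositional using (_∈_)
  open import Data.List.Membership.Propositional.Properties using (∈-∃++; ∈-++⁻; ∈-++⁺ˡ; ∈-++⁺ʳ; ∈-upTo⁺; ∈-upTo⁻)
  open import Data.List.Relation.Binary.Sublist.Propositional as SL using (_⊆_; []; _∷ʳ_; _∷_; ⊆-refl; ⊆-trans)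
  open import Data.List.Relation.Binary.Permutation.Propositional using (_↭_; ↭-sym)
  import Data.List.Relation.Binary.Permutation.Propositional.Properties as PP
  open import Data.List.Relation.Unary.Unique.Propositional using (Unique)
  open import Data.List.Relation.Unary.Unique.Propositional.Properties using (upTo⁺; map⁻)
  open import Relation.Binary using (tri<; tri≈; tri>)


  ∈⇒⊆ : ∀ {x : ℕ} {l} → x ∈ l → (x ∷ []) ⊆ l
  ∈⇒⊆ {l = y ∷ l} (here refl) = refl ∷ []⊆ l
  ∈⇒⊆ {l = y ∷ l} (there p) = y ∷ʳ ∈⇒⊆ p

  ++⊆ : ∀ {as xs bs ys : List ℕ} → as ⊆ xs → bs ⊆ ys → as L.++ bs ⊆ xs L.++ ys
  ++⊆ [] q = q
  ++⊆ (y ∷ʳ p) q = y ∷ʳ ++⊆ p q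
  ++⊆ (e ∷ p) q = e ∷ ++⊆ p q

  contains132-⊆ : ∀ {xs σ} → Contains132 xs → xs ⊆ σ → Contains132 σ
  contains132-⊆ (a , b , c , s , p , q) t = a , b , c , ⊆-trans s t , p , q

  lt-suc-neq : ∀ {x n} → x < suc n → x ≢ n → x < n
  lt-suc-neq {x} {n} p ne with NP.m≤n⇒m<n∨m≡n (NP.≤-pred p)
  ... | inj₁ q = q
  ... | inj₂ e = ⊥-elim (ne e)

  raise-lower : ∀ r xs → All (r ≤_) xs → raise r (map (_∸ r) xs) ≡ xs
  raise-lower r [] [] = refl
  raise-lower r (x ∷ xs) (p ∷ ps) = cong₂ _∷_ (NP.m+[n∸m]≡n p) (raise-lower r xs ps)

  module SplitAtMax (n : ℕ) (xs ys : List ℕ) (pσ : xs ++ n ∷ ys ↭ upTo (suc n))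
                    (n1 : ¬ Contains132 (xs ++ n ∷ ys)) (n2 : ¬ Contains123c (xs ++ n ∷ ys)) where

    σ' : List ℕ
    σ' = xs ++ n ∷ ys
    u : Unique σ'
    u = Unique-resp-↭ (↭-sym pσ) (upTo⁺ (suc n))
    bσ : All (_< suc n) σ'
    bσ = perm-bounded pσ
    n∉ys : ¬ (n ∈ ys)
    n∉ys = Unique-head (Unique-++ʳ xs u)
    bx : All (_< n) xs
    bx = All.tabulate (λ {x} x∈ → lt-suc-neq (All.lookup bσ (∈-++⁺ˡ x∈)) (λ e → Unique-++-disjoint xs u x∈ (here e)))
    by : All (_< n) ys
    by = All.tabulate (λ {y} y∈ → lt-suc-neq (All.lookup bσ (∈-++⁺ʳ xs (there y∈))) (λ e → n∉ys (subst (_∈ ys) e y∈)))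
    sep : ∀ {x y} → x ∈ xs → y ∈ ys → y < x
    sep {x} {y} x∈ y∈ with NP.<-cmp x y
    ... | tri< x<y _ _ = ⊥-elim (n1 (x , n , y , ++⊆ (∈⇒⊆ x∈) (refl ∷ ∈⇒⊆ y∈) , x<y , All.lookup by y∈))
    ... | tri≈ _ e _ = ⊥-elim (Unique-++-disjoint xs u x∈ (there (subst (_∈ ys) (sym e) y∈)))
    ... | tri> _ _ y<x = y<x
    m r : ℕ
    m = length xs
    r = length ys
    lenσ : m + suc r ≡ suc n
    lenσ = trans (sym (LP.length-++ xs)) (trans (PP.↭-length pσ) (LP.length-upTo (suc n)))
    m+r : m + r ≡ n
    m+r = NP.suc-injective (trans (sym (NP.+-suc m r)) lenσ)
    m≤n : m ≤ n
    m≤n = subst (m ≤_) m+r (NP.m≤m+n m r)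
    n∸m≡r : n ∸ m ≡ r
    n∸m≡r = trans (cong (_∸ m) (sym m+r)) (NP.m+n∸m≡n m r)
    uys : Unique ys
    uys = Data.List.Relation.Unary.AllPairs.tail (Unique-++ʳ xs u)
      where import Data.List.Relation.Unary.AllPairs
    -- the entries after n are the r smallest values, so ys is a permutation
    ys<r : All (_< r) ys
    ys<r = All.tabulate (λ {y} y∈ → NP.≤-trans (NP.≤-reflexive (sym (LP.length-upTo (suc y))))
        (Unique⇒length≤ (upTo (suc y)) ys (upTo⁺ (suc y)) (sub y y∈)))
      where
      sub : ∀ y → y ∈ ys → ∀ {w} → w ∈ upTo (suc y) → w ∈ ys
      sub y y∈ {w} w∈ with ∈-++⁻ xs (PP.∈-resp-↭ (↭-sym pσ) (∈-upTo⁺ {suc n} {w} (NP.≤-trans (∈-upTo⁻ w∈) (NP.<⇒≤ (s≤s (All.lookup by y∈))))))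
      ... | inj₁ w∈xs = ⊥-elim (NP.<-irrefl refl (NP.<-≤-trans (sep w∈xs y∈) (NP.≤-pred (∈-upTo⁻ w∈))))
      ... | inj₂ (here e) = ⊥-elim (NP.<-irrefl e (NP.≤-<-trans (NP.≤-pred (∈-upTo⁻ w∈)) (All.lookup by y∈)))
      ... | inj₂ (there w∈ys) = w∈ys
    pys : ys ↭ upTo r
    pys = perm-criterion ys r uys ys<r refl
    xs≥r : All (r ≤_) xs
    xs≥r = All.tabulate (λ {x} x∈ → NP.≮⇒≥ (λ x<r → Unique-++-disjoint xs u x∈ (there (PP.∈-resp-↭ (↭-sym pys) (∈-upTo⁺ x<r)))))
    α : List ℕ
    α = map (_∸ r) xs
    sbα : raise r α ≡ xs
    sbα = raise-lower r xs xs≥r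
    uα : Unique α
    uα = map⁻ (subst Unique (sym sbα) (Unique-++ˡ xs u))
    bα : All (_< m) α
    bα = All.tabulate (λ {a} a∈ → lem a∈)
      where
      lem : ∀ {a} → a ∈ α → a < m
      lem {a} a∈ with Data.List.Membership.Propositional.Properties.∈-map⁻ (_∸ r) a∈
        where import Data.List.Membership.Propositional.Properties
      ... | x , x∈ , refl = NP.+-cancelˡ-< r (x ∸ r) m (subst (_< r + m) (sym (NP.m+[n∸m]≡n (All.lookup xs≥r x∈)))
          (subst (x <_) (trans (sym m+r) (NP.+-comm m r)) (All.lookup bx x∈)))
    pα : α ↭ upTo m
    pα = perm-criterion α m uα bα (LP.length-map (_∸ r) xs)
    n1α : ¬ Contains132 α
    n1α c = n1 (contains132-⊆ (subst Contains132 sbα (contains132-raise⁺ r α c))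
        (subst (_⊆ σ') (LP.++-identityʳ xs) (++⊆ {xs} {xs} {[]} {n ∷ ys} ⊆-refl ([]⊆ (n ∷ ys)))))
    n2α : ¬ Contains123c α
    n2α c = n2 (Asc3⇒contains123c σ' (Asc3-++ʳ xs (n ∷ ys) (subst Asc3 sbα (Asc3-raise⁺ r α (contains123c⇒Asc3 α c)))))
    n1ys : ¬ Contains132 ys
    n1ys c = n1 (contains132-⊆ c (++⊆ ([]⊆ xs) (n ∷ʳ ⊆-refl)))
    n2ys : ¬ Contains123c ys
    n2ys c = n2 (Asc3⇒contains123c σ' (Asc3-++ˡ xs (n ∷ ys) (Asc3-++ˡ (n ∷ []) ys (contains123c⇒Asc3 ys c))))
    -- an ascent at the end of α followed by n would be a consecutive 123
    eα : endsAsc α ≡ false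
    eα with endsAsc α in eq
    ... | false = refl
    ... | true = ⊥-elim (n2 (Asc3⇒contains123c σ' (endsAsc⇒Asc3 n xs ys bx (trans (sym (cong endsAsc sbα)) (trans (endsAsc-raise r α) eq)))))
    eqσ : σ' ≡ join n m α ys
    eqσ = cong (λ z → z ++ n ∷ ys) (trans (sym sbα) (cong (λ z → raise z α) (sym n∸m≡r)))


  decompose : ∀ n σ → InS (suc n) σ → ∃ λ m → ∃ λ α → ∃ λ β →
    m ≤ n × σ ≡ join n m α β × InS m α × InS (n ∸ m) β × endsAsc α ≡ false
  decompose n σ (pσ , n1 , n2) with ∈-∃++ (PP.∈-resp-↭ (↭-sym pσ) (∈-upTo⁺ (NP.n<1+n n)))
  ... | xs , ys , refl =
    m , α , ys , m≤n , eqσ , (pα , n1α , n2α) , subst (λ z → InS z ys) (sym n∸m≡r) (pys , n1ys , n2ys) , eα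
    where open SplitAtMax n xs ys pσ n1 n2

-- A join determines its parts, and two statistics read off a join recover
-- the size m and the occ321 of its left part; they are used as keys to show
-- that the enumeration of joins has no repetitions.
module JoinInjective where

  open Patterns
  open Joining
  open Decomposition
  open import Data.Nat as ℕ using (ℕ; zero; suc; _∸_; _<_; _≤_; _≡ᵇ_)
  import Data.Nat.Properties as NP
  open import Data.List as L using (List; []; _∷_; _++_; length; take)
  import Data.List.Properties as LP
  open import Data.Product using (_×_; _,_; proj₁)
  open import Data.Bool using (Bool; true; false; if_then_else_)
  open import Relation.Binary.PropositionalEquality as Eq using (_≡_; refl; cong; sym; trans; subst)
  open import Data.List.Relation.Unary.All as All using (All; []; _∷_)
  open import Data.Empty using (⊥-elim)
  import Data.Unit

  indexOf : ℕ → List ℕ → ℕ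
  indexOf n [] = 0
  indexOf n (x ∷ xs) = if x ≡ᵇ n then 0 else suc (indexOf n xs)

  ≡ᵇ-refl : ∀ n → (n ≡ᵇ n) ≡ true
  ≡ᵇ-refl zero = refl
  ≡ᵇ-refl (suc n) = ≡ᵇ-refl n

  indexOf-++ : ∀ n xs ys → All (_< n) xs → indexOf n (xs ++ n ∷ ys) ≡ length xs
  indexOf-++ n [] ys _ rewrite ≡ᵇ-refl n = refl
  indexOf-++ n (x ∷ xs) ys (p ∷ ps) with x ≡ᵇ n in eq
  ... | true = ⊥-elim (NP.<-irrefl (NP.≡ᵇ⇒≡ x n (subst Data.Bool.T (sym eq) Data.Unit.tt)) p)
  ... | false = cong suc (indexOf-++ n xs ys ps)

  take-++' : ∀ (xs ys : List ℕ) → take (length xs) (xs ++ ys) ≡ xs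
  take-++' [] ys = refl
  take-++' (x ∷ xs) ys = cong (x ∷_) (take-++' xs ys)

  prefixOcc : ℕ → List ℕ → ℕ
  prefixOcc n σ = occ321 (take (indexOf n σ) σ)

  indexOf-join : ∀ {n m α β} → m ≤ n → InS m α → indexOf n (join n m α β) ≡ m
  indexOf-join {n} {m} {α} {β} p iα = trans (indexOf-++ n (raise (n ∸ m) α) β (join-boundˡ p iα))
    (trans (LP.length-map _ α) (trans (PP.↭-length (proj₁ iα)) (LP.length-upTo m)))
    where import Data.List.Relation.Binary.Permutation.Propositional.Properties as PP

  prefixOcc-join : ∀ {n m α β} → m ≤ n → InS m α → prefixOcc n (join n m α β) ≡ occ321 α
  prefixOcc-join {n} {m} {α} {β} p iα rewrite indexOf-++ n (raise (n ∸ m) α) β (join-boundˡ p iα) =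
    trans (cong occ321 (take-++' (raise (n ∸ m) α) (n ∷ β))) (occ321-raise (n ∸ m) α)

  ++-inj : ∀ (xs xs' ys ys' : List ℕ) → length xs ≡ length xs' → xs ++ ys ≡ xs' ++ ys' → xs ≡ xs' × ys ≡ ys'
  ++-inj [] [] ys ys' _ e = refl , e
  ++-inj (x ∷ xs) (x' ∷ xs') ys ys' l e with LP.∷-injective e
  ... | refl , e' with ++-inj xs xs' ys ys' (NP.suc-injective l) e'
  ... | refl , refl = refl , refl

  join-injective : ∀ {n m α α' β β'} → length α ≡ length α' → join n m α β ≡ join n m α' β' → α ≡ α' × β ≡ β'
  join-injective {n} {m} {α} {α'} {β} {β'} l e with ++-inj (raise (n ∸ m) α) (raise (n ∸ m) α') (n ∷ β) (n ∷ β') (trans (LP.length-map _ α)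
      (trans l (sym (LP.length-map _ α')))) e
  ... | e1 , e2 = LP.map-injective (λ {a} {b} → NP.+-cancelˡ-≡ (n ∸ m) a b) e1 , LP.∷-injectiveʳ e2


module ListEnumeration where

  open import Data.Nat as ℕ using (suc; _+_; _*_)
  open import Data.Integer as ℤ using (ℤ; +_)
  import Data.Integer.Properties as ℤP
  open import Data.List as L using (List; []; _∷_; map; length; concatMap; cartesianProduct)
  import Data.List.Properties as LP
  open import Data.Bool using (Bool; true; false; _∧_; not; if_then_else_)
  open import Data.Product using (∃; _×_; _,_; proj₁)
  open import Data.Sum using (inj₁; inj₂)
  open import Data.Empty using (⊥)
  open import Relation.Binary.PropositionalEquality as Eq using (_≡_; refl; cong; cong₂; sym; trans)
  open import Data.List.Relation.Unary.All as All using (All; []; _∷_)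
  open import Data.List.Relation.Unary.AllPairs using ([]; _∷_)
  open import Data.List.Relation.Unary.Any using (here; there)
  open import Data.List.Membership.Propositional using (_∈_)
  open import Data.List.Membership.Propositional.Properties using (∈-++⁻; ∈-++⁺ˡ; ∈-++⁺ʳ)
  open import Data.List.Relation.Unary.Unique.Propositional using (Unique)
  open import Data.List.Relation.Unary.Unique.Propositional.Properties using (++⁺)

  module _ {A : Set} where

    -- boolean filter, unfolding definitionally by cases on p x
    select : (A → Bool) → List A → List A
    select p [] = []
    select p (x ∷ xs) = if p x then x ∷ select p xs else select p xs

    select-∈⁺ : ∀ (p : A → Bool) {x xs} → x ∈ xs → p x ≡ true → x ∈ select p xs
    select-∈⁺ p {x} {y ∷ xs} (here refl) e rewrite e = here refl
    select-∈⁺ p {x} {y ∷ xs} (there x∈) e with p y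
    ... | true = there (select-∈⁺ p x∈ e)
    ... | false = select-∈⁺ p x∈ e

    select-∈⁻ : ∀ (p : A → Bool) {x} xs → x ∈ select p xs → x ∈ xs × p x ≡ true
    select-∈⁻ p (y ∷ xs) x∈ with p y in eq
    select-∈⁻ p (y ∷ xs) (here refl) | true = here refl , eq
    select-∈⁻ p (y ∷ xs) (there x∈) | true with select-∈⁻ p xs x∈
    ... | a , b = there a , b
    select-∈⁻ p (y ∷ xs) x∈ | false with select-∈⁻ p xs x∈
    ... | a , b = there a , b

    select-⊆ : ∀ (p : A → Bool) xs {x} → x ∈ select p xs → x ∈ xs
    select-⊆ p xs x∈ = proj₁ (select-∈⁻ p xs x∈)

    All-sub : ∀ {P : A → Set} {xs ys : List A} → (∀ {x} → x ∈ xs → x ∈ ys) → All P ys → All P xs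
    All-sub {xs = xs} sub a = All.tabulate (λ x∈ → All.lookup a (sub x∈))

    select-Unique : ∀ (p : A → Bool) {xs} → Unique xs → Unique (select p xs)
    select-Unique p {[]} u = []
    select-Unique p {y ∷ xs} (a ∷ u) with p y
    ... | true = All-sub (select-⊆ p xs) a ∷ select-Unique p u
    ... | false = select-Unique p u

    select-split : ∀ (p q : A → Bool) xs → length (select p xs) ≡ length (select (λ x → p x ∧ q x) xs) + length (select (λ x → p x ∧ not (q x)) xs)
    select-split p q [] = refl
    select-split p q (x ∷ xs) with p x | q x
    ... | true | true = cong suc (select-split p q xs)
    ... | true | false = trans (cong suc (select-split p q xs)) (sym (NP.+-suc _ _))
      where import Data.Nat.Properties as NP
    ... | false | _ = select-split p q xs

    select-cong : ∀ (p q : A → Bool) xs → (∀ x → x ∈ xs → p x ≡ q x) → select p xs ≡ select q xs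
    select-cong p q [] e = refl
    select-cong p q (x ∷ xs) e rewrite e x (here refl) with q x
    ... | true = cong (x ∷_) (select-cong p q xs (λ y y∈ → e y (there y∈)))
    ... | false = select-cong p q xs (λ y y∈ → e y (there y∈))

    select-none : ∀ (p : A → Bool) xs → (∀ x → x ∈ xs → p x ≡ false) → select p xs ≡ []
    select-none p [] e = refl
    select-none p (x ∷ xs) e rewrite e x (here refl) = select-none p xs (λ y y∈ → e y (there y∈))

  module _ {A B : Set} where

    ∈-concatMap⁺ : ∀ (f : A → List B) {x xs y} → x ∈ xs → y ∈ f x → y ∈ concatMap f xs
    ∈-concatMap⁺ f {xs = x ∷ xs} (here refl) y∈ = ∈-++⁺ˡ y∈
    ∈-concatMap⁺ f {xs = x' ∷ xs} (there x∈) y∈ = ∈-++⁺ʳ (f x') (∈-concatMap⁺ f x∈ y∈)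

    ∈-concatMap⁻ : ∀ (f : A → List B) xs {y} → y ∈ concatMap f xs → ∃ λ x → x ∈ xs × y ∈ f x
    ∈-concatMap⁻ f (x ∷ xs) y∈ with ∈-++⁻ (f x) y∈
    ... | inj₁ p = x , here refl , p
    ... | inj₂ p with ∈-concatMap⁻ f xs p
    ... | x' , x'∈ , q = x' , there x'∈ , q

    length-concatMap : ∀ (f : A → List B) xs → + length (concatMap f xs) ≡ sumℤ (map (λ x → + length (f x)) xs)
    length-concatMap f [] = refl
    length-concatMap f (x ∷ xs) = trans (cong +_ (LP.length-++ (f x))) (cong (λ z → + length (f x) ℤ.+ z) (length-concatMap f xs))

    Unique-concatMap : ∀ (B' : A → List B) (key : B → A) xs → Unique xs → (∀ x → x ∈ xs → Unique (B' x)) →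
                       (∀ x y → x ∈ xs → y ∈ B' x → key y ≡ x) → Unique (concatMap B' xs)
    Unique-concatMap B' key [] u ub k = []
    Unique-concatMap B' key (x ∷ xs) (a ∷ u) ub k = ++⁺ (ub x (here refl)) (Unique-concatMap B' key xs u (λ x' p → ub x' (there p))
        (λ x' y p → k x' y (there p))) disj
      where
      disj : ∀ {y} → y ∈ B' x × y ∈ concatMap B' xs → ⊥
      disj {y} (y∈₁ , y∈₂) with ∈-concatMap⁻ B' xs y∈₂
      ... | x' , x'∈ , y∈' = All.lookup a x'∈ (trans (sym (k x y (here refl) y∈₁)) (k x' y (there x'∈) y∈'))

    Unique-map : ∀ (g : A → B) xs → Unique xs → (∀ x y → x ∈ xs → y ∈ xs → g x ≡ g y → x ≡ y) → Unique (map g xs)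
    Unique-map g [] u inj = []
    Unique-map g (x ∷ xs) (a ∷ u) inj = All.tabulate (λ {z} z∈ e → lem z∈ e) ∷ Unique-map g xs u (λ p q p∈ q∈ → inj p q (there p∈) (there q∈))
      where
      open import Data.List.Membership.Propositional.Properties using (∈-map⁻)
      lem : ∀ {z} → z ∈ map g xs → g x ≡ z → ⊥
      lem z∈ e with ∈-map⁻ g z∈
      ... | w , w∈ , refl = All.lookup a w∈ (inj x w (here refl) (there w∈) e)

  length-cartesianProduct : ∀ {A B : Set} (xs : List A) (ys : List B) → length (cartesianProduct xs ys) ≡ length xs * length ys
  length-cartesianProduct [] ys = refl
  length-cartesianProduct (x ∷ xs) ys = trans (LP.length-++ (map (x ,_) ys)) (cong₂ _+_ (LP.length-map (x ,_) ys) (length-cartesianProduct xs ys))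


-- Given enumerations L n k of the
-- permutations in S_n(132, 123) with k occurrences of 321, count those
-- satisfying a boolean property q.  When q of a join only depends on q-like
-- properties ua of the left part and vb of the right part, the count in size
-- n+1 is the coefficient of xⁿtᵏ in (left series) ⊛ (weighted right series):
-- the left part contributes its occ321, the right part occ321 plus one when
-- it starts with a descent.
module Products where

  open Patterns
  open Joining
  open Decomposition
  open JoinInjective
  open ListEnumeration
  open DistinctLists using (same-length)
  open import Data.Nat as ℕ using (ℕ; zero; suc; _+_; _∸_; _≤_; s≤s)
  import Data.Nat.Properties as NP
  open import Data.Integer as ℤ using (+_)
  import Data.Integer.Properties as ℤP
  open import Data.List as L using (List; _++_; map; length; upTo; concatMap; cartesianProduct)
  import Data.List.Properties as LP
  open import Data.Product using (∃; _×_; _,_; proj₁; proj₂)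
  open import Data.Bool using (Bool; true; false; _∧_; not)
  open import Data.Bool.Properties using (not-injective)
  open import Data.Sum using (inj₁; inj₂)
  open import Data.Empty using (⊥)
  open import Relation.Binary.PropositionalEquality as Eq using (_≡_; refl; cong; cong₂; sym; trans; subst)
  open import Function.Bundles using (_⇔_; mk⇔; Equivalence)
  open import Data.List.Membership.Propositional using (_∈_)
  open import Data.List.Membership.Propositional.Properties using (∈-++⁻; ∈-++⁺ˡ; ∈-++⁺ʳ; ∈-upTo⁺; ∈-upTo⁻; ∈-map⁺; ∈-map⁻; ∈-cartesianProduct⁺;
      ∈-cartesianProduct⁻)
  open import Data.List.Relation.Unary.Unique.Propositional using (Unique)
  open import Data.List.Relation.Unary.Unique.Propositional.Properties using (++⁺; upTo⁺; cartesianProduct⁺)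
  import Data.List.Relation.Binary.Permutation.Propositional.Properties as PP

  ∧-true : ∀ {a b} → a ∧ b ≡ true → a ≡ true × b ≡ true
  ∧-true {true} {true} _ = refl , refl

  ∧-true⁺ : ∀ {a b} → a ≡ true → b ≡ true → a ∧ b ≡ true
  ∧-true⁺ refl refl = refl

  Compatible : ℕ → (q ua vb : List ℕ → Bool) → Set
  Compatible n q ua vb = ∀ m α β → m ≤ n → InS m α → InS (n ∸ m) β → endsAsc α ≡ false → q (join n m α β) ≡ ua α ∧ vb β

  InS-length : ∀ {m α} → InS m α → length α ≡ m
  InS-length (p , _) = trans (PP.↭-length p) (LP.length-upTo _)

  module ProductFormula (L : ℕ → ℕ → List (List ℕ))
             (L-Unique : ∀ n k → Unique (L n k))
             (L-members : ∀ n k σ → (σ ∈ L n k) ⇔ (InS n σ × occ321 σ ≡ k)) where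

    inL⁻ : ∀ {n k σ} → σ ∈ L n k → InS n σ × occ321 σ ≡ k
    inL⁻ {n} {k} {σ} p = Equivalence.to (L-members n k σ) p

    inL⁺ : ∀ {n k σ} → InS n σ → occ321 σ ≡ k → σ ∈ L n k
    inL⁺ {n} {k} {σ} i e = Equivalence.from (L-members n k σ) (i , e)

    count : (List ℕ → Bool) → ℕ → ℕ → ℕ
    count p n k = length (select p (L n k))

    -- right parts β ∈ S_r with vb β, of weight startWeight β + occ321 β = i
    weightedList : (List ℕ → Bool) → ℕ → ℕ → List (List ℕ)
    weightedList vb r zero = select (λ β → vb β ∧ not (startsDesc β)) (L r zero)
    weightedList vb r (suc i) = select (λ β → vb β ∧ not (startsDesc β)) (L r (suc i)) ++ select (λ β → vb β ∧ startsDesc β) (L r i)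

    weightedCount : (List ℕ → Bool) → ℕ → ℕ → ℕ
    weightedCount vb r i = length (weightedList vb r i)

    leftList : (List ℕ → Bool) → ℕ → ℕ → List (List ℕ)
    leftList ua m j = select (λ α → not (endsAsc α) ∧ ua α) (L m j)

    leftCount : (List ℕ → Bool) → ℕ → ℕ → ℕ
    leftCount ua m j = length (leftList ua m j)

    startWeight-0 : ∀ β → startsDesc β ≡ false → startWeight β ≡ 0
    startWeight-0 β e rewrite e = refl

    startWeight-1 : ∀ β → startsDesc β ≡ true → startWeight β ≡ 1
    startWeight-1 β e rewrite e = refl

    weightedList-∈⁻ : ∀ vb r i {β} → β ∈ weightedList vb r i → InS r β × startWeight β + occ321 β ≡ i × vb β ≡ true
    weightedList-∈⁻ vb r zero {β} p with select-∈⁻ _ (L r zero) p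
    ... | q , e with ∧-true {vb β} e | inL⁻ q
    ... | v , s | i , o = i , trans (cong (_+ occ321 β) (startWeight-0 β (not-injective s))) o , v
    weightedList-∈⁻ vb r (suc i) {β} p with ∈-++⁻ (select (λ β → vb β ∧ not (startsDesc β)) (L r (suc i))) p
    ... | inj₁ p' with select-∈⁻ _ (L r (suc i)) p'
    ... | q , e with ∧-true {vb β} e | inL⁻ q
    ... | v , s | ii , o = ii , trans (cong (_+ occ321 β) (startWeight-0 β (not-injective s))) o , v
    weightedList-∈⁻ vb r (suc i) {β} p | inj₂ p' with select-∈⁻ _ (L r i) p'
    ... | q , e with ∧-true {vb β} e | inL⁻ q
    ... | v , s | ii , o = ii , trans (cong (_+ occ321 β) (startWeight-1 β s)) (cong suc o) , v

    weightedList-∈⁺ : ∀ vb r i {β} → InS r β → startWeight β + occ321 β ≡ i → vb β ≡ true → β ∈ weightedList vb r i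
    weightedList-∈⁺ vb r i {β} iβ o v with startsDesc β in es
    weightedList-∈⁺ vb r zero {β} iβ o v | false = select-∈⁺ _ (inL⁺ iβ o) (∧-true⁺ v (cong not es))
    weightedList-∈⁺ vb r (suc i) {β} iβ o v | false = ∈-++⁺ˡ (select-∈⁺ _ (inL⁺ iβ o) (∧-true⁺ v (cong not es)))
    weightedList-∈⁺ vb r zero {β} iβ () v | true
    weightedList-∈⁺ vb r (suc i) {β} iβ o v | true = ∈-++⁺ʳ (select (λ β → vb β ∧ not (startsDesc β)) (L r (suc i))) (select-∈⁺ _
        (inL⁺ iβ (NP.suc-injective o)) (∧-true⁺ v es))

    weightedList-Unique : ∀ vb r i → Unique (weightedList vb r i)
    weightedList-Unique vb r zero = select-Unique _ (L-Unique r zero)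
    weightedList-Unique vb r (suc i) = ++⁺ (select-Unique _ (L-Unique r (suc i))) (select-Unique _ (L-Unique r i)) disj
      where
      disj : ∀ {β} → β ∈ select (λ β → vb β ∧ not (startsDesc β)) (L r (suc i)) × β ∈ select (λ β → vb β ∧ startsDesc β) (L r i) → ⊥
      disj {β} (p , q) with ∧-true {vb β} (proj₂ (select-∈⁻ _ (L r (suc i)) p)) | ∧-true {vb β} (proj₂ (select-∈⁻ _ (L r i) q))
      ... | _ , s1 | _ , s2 rewrite s2 with s1
      ... | ()

    leftList-∈⁻ : ∀ ua m j {α} → α ∈ leftList ua m j → InS m α × occ321 α ≡ j × endsAsc α ≡ false × ua α ≡ true
    leftList-∈⁻ ua m j {α} p with select-∈⁻ _ (L m j) p
    ... | q , e with ∧-true {not (endsAsc α)} e | inL⁻ q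
    ... | ne , u | i , o = i , o , not-injective ne , u

    leftList-∈⁺ : ∀ ua m j {α} → InS m α → occ321 α ≡ j → endsAsc α ≡ false → ua α ≡ true → α ∈ leftList ua m j
    leftList-∈⁺ ua m j {α} i o e u = select-∈⁺ _ (inL⁺ i o) (∧-true⁺ (cong not e) u)

    joinPair : ℕ → ℕ → List ℕ × List ℕ → List ℕ
    joinPair n m ab = join n m (proj₁ ab) (proj₂ ab)

    joinsAt : (List ℕ → Bool) → (List ℕ → Bool) → ℕ → ℕ → ℕ → ℕ → List (List ℕ)
    joinsAt ua vb n k m j = map (joinPair n m) (cartesianProduct (leftList ua m j) (weightedList vb (n ∸ m) (k ∸ j)))

    joinsWithLeftSize : (List ℕ → Bool) → (List ℕ → Bool) → ℕ → ℕ → ℕ → List (List ℕ)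
    joinsWithLeftSize ua vb n k m = concatMap (joinsAt ua vb n k m) (upTo (suc k))

    joins : (List ℕ → Bool) → (List ℕ → Bool) → ℕ → ℕ → List (List ℕ)
    joins ua vb n k = concatMap (joinsWithLeftSize ua vb n k) (upTo (suc n))

    joinsAt-∈⁻ : ∀ ua vb n k m j {σ} → σ ∈ joinsAt ua vb n k m j →
                 ∃ λ α → ∃ λ β → σ ≡ join n m α β × α ∈ leftList ua m j × β ∈ weightedList vb (n ∸ m) (k ∸ j)
    joinsAt-∈⁻ ua vb n k m j p with ∈-map⁻ (joinPair n m) p
    ... | (α , β) , ab∈ , refl with ∈-cartesianProduct⁻ (leftList ua m j) (weightedList vb (n ∸ m) (k ∸ j)) ab∈
    ... | a∈ , b∈ = α , β , refl , a∈ , b∈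

    joinsAt-Unique : ∀ ua vb n k m j → Unique (joinsAt ua vb n k m j)
    joinsAt-Unique ua vb n k m j = Unique-map (joinPair n m) _ (cartesianProduct⁺ (select-Unique _ (L-Unique m j))
        (weightedList-Unique vb (n ∸ m) (k ∸ j))) inj
      where
      inj : ∀ x y → x ∈ cartesianProduct (leftList ua m j) (weightedList vb (n ∸ m) (k ∸ j)) →
            y ∈ cartesianProduct (leftList ua m j) (weightedList vb (n ∸ m) (k ∸ j)) → joinPair n m x ≡ joinPair n m y → x ≡ y
      inj (α , β) (α' , β') x∈ y∈ e
        with ∈-cartesianProduct⁻ (leftList ua m j) (weightedList vb (n ∸ m) (k ∸ j)) x∈
           | ∈-cartesianProduct⁻ (leftList ua m j) (weightedList vb (n ∸ m) (k ∸ j)) y∈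
      ... | a∈ , _ | a'∈ , _ with join-injective {n} {m} {α} {α'} {β} {β'} (trans (InS-length (proj₁ (leftList-∈⁻ ua m j a∈)))
          (sym (InS-length (proj₁ (leftList-∈⁻ ua m j a'∈))))) e
      ... | refl , refl = refl

    -- the union is disjoint: indexOf recovers m and prefixOcc recovers j
    joins-Unique : ∀ ua vb n k → Unique (joins ua vb n k)
    joins-Unique ua vb n k = Unique-concatMap (joinsWithLeftSize ua vb n k) (indexOf n) (upTo (suc n)) (upTo⁺ (suc n)) innerU key1
      where
      innerU : ∀ m → m ∈ upTo (suc n) → Unique (joinsWithLeftSize ua vb n k m)
      innerU m m∈ = Unique-concatMap (joinsAt ua vb n k m) (prefixOcc n) (upTo (suc k)) (upTo⁺ (suc k)) (λ j _ → joinsAt-Unique ua vb n k m j) key2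
        where
        key2 : ∀ j σ → j ∈ upTo (suc k) → σ ∈ joinsAt ua vb n k m j → prefixOcc n σ ≡ j
        key2 j σ _ σ∈ with joinsAt-∈⁻ ua vb n k m j σ∈
        ... | α , β , refl , a∈ , _ with leftList-∈⁻ ua m j a∈
        ... | iα , o , _ = trans (prefixOcc-join {n} {m} {α} {β} (NP.≤-pred (∈-upTo⁻ m∈)) iα) o
      key1 : ∀ m σ → m ∈ upTo (suc n) → σ ∈ joinsWithLeftSize ua vb n k m → indexOf n σ ≡ m
      key1 m σ m∈ σ∈ with ∈-concatMap⁻ (joinsAt ua vb n k m) (upTo (suc k)) σ∈
      ... | j , _ , σ∈' with joinsAt-∈⁻ ua vb n k m j σ∈'
      ... | α , β , refl , a∈ , _ = indexOf-join {n} {m} {α} {β} (NP.≤-pred (∈-upTo⁻ m∈)) (proj₁ (leftList-∈⁻ ua m j a∈))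

    module _ (q ua vb : List ℕ → Bool) (n k : ℕ) (H : Compatible n q ua vb) where

      joins⇒ : ∀ {σ} → σ ∈ joins ua vb n k → σ ∈ select q (L (suc n) k)
      joins⇒ {σ} p with ∈-concatMap⁻ (joinsWithLeftSize ua vb n k) (upTo (suc n)) p
      ... | m , m∈ , p' with ∈-concatMap⁻ (joinsAt ua vb n k m) (upTo (suc k)) p'
      ... | j , j∈ , p'' with joinsAt-∈⁻ ua vb n k m j p''
      ... | α , β , refl , a∈ , b∈ with leftList-∈⁻ ua m j a∈ | weightedList-∈⁻ vb (n ∸ m) (k ∸ j) b∈
      ... | iα , oα , eα , uα | iβ , oβ , vβ =
        select-∈⁺ q (inL⁺ (join-InS m≤n iα iβ eα) (trans (occ321-join m≤n iα iβ) (trans (cong₂ _+_ oα oβ) (NP.m+[n∸m]≡n j≤k))))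
          (trans (H m α β m≤n iα iβ eα) (∧-true⁺ uα vβ))
        where
        m≤n : m ≤ n
        m≤n = NP.≤-pred (∈-upTo⁻ m∈)
        j≤k : j ≤ k
        j≤k = NP.≤-pred (∈-upTo⁻ j∈)

      joins⇐ : ∀ {σ} → σ ∈ select q (L (suc n) k) → σ ∈ joins ua vb n k
      joins⇐ {σ} p with select-∈⁻ q (L (suc n) k) p
      ... | σ∈ , qσ with inL⁻ σ∈
      ... | iσ , oσ with decompose n σ iσ
      ... | m , α , β , m≤n , refl , iα , iβ , eα with ∧-true {ua α} (trans (sym (H m α β m≤n iα iβ eα)) qσ)
      ... | uα , vβ = ∈-concatMap⁺ (joinsWithLeftSize ua vb n k) (∈-upTo⁺ (s≤s m≤n))
                       (∈-concatMap⁺ (joinsAt ua vb n k m) (∈-upTo⁺ (s≤s j≤k))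
                         (∈-map⁺ (joinPair n m) (∈-cartesianProduct⁺ (leftList-∈⁺ ua m j iα refl eα uα)
                             (weightedList-∈⁺ vb (n ∸ m) (k ∸ j) iβ oβ vβ))))
        where
        j : ℕ
        j = occ321 α
        tot : j + (startWeight β + occ321 β) ≡ k
        tot = trans (sym (occ321-join m≤n iα iβ)) oσ
        j≤k : j ≤ k
        j≤k = subst (j ≤_) tot (NP.m≤m+n j _)
        oβ : startWeight β + occ321 β ≡ k ∸ j
        oβ = trans (sym (NP.m+n∸m≡n j _)) (cong (_∸ j) tot)

      count-joins : count q (suc n) k ≡ length (joins ua vb n k)
      count-joins = same-length (select-Unique q (L-Unique (suc n) k)) (joins-Unique ua vb n k) (mk⇔ joins⇐ joins⇒)

      product-formula : + count q (suc n) k ≡ (ofℕ (leftCount ua) ⊛ ofℕ (weightedCount vb)) n k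
      product-formula =
        trans (cong +_ count-joins)
        (trans (length-concatMap (joinsWithLeftSize ua vb n k) (upTo (suc n)))
        (cong sumℤ (LP.map-cong (λ m →
          trans (length-concatMap (joinsAt ua vb n k m) (upTo (suc k)))
          (cong sumℤ (LP.map-cong (λ j → block-size m j) (upTo (suc k))))) (upTo (suc n)))))
        where
        block-size : ∀ m j → + length (joinsAt ua vb n k m j) ≡ + leftCount ua m j ℤ.* + weightedCount vb (n ∸ m) (k ∸ j)
        block-size m j =
          trans (cong +_ (trans (LP.length-map (joinPair n m) (cartesianProduct (leftList ua m j) (weightedList vb (n ∸ m) (k ∸ j))))
                                (length-cartesianProduct (leftList ua m j) (weightedList vb (n ∸ m) (k ∸ j)))))
                (ℤP.pos-* (leftCount ua m j) (weightedCount vb (n ∸ m) (k ∸ j)))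


module BoundaryStatistics where

  open Patterns
  open Joining
  open Decomposition
  open JoinInjective
  open import Data.Nat as ℕ using (ℕ; _+_; _∸_; _<_; _≤_; _≡ᵇ_)
  import Data.Nat.Properties as NP
  open import Data.List as L using (List; []; _∷_; _++_; null)
  open import Data.Bool using (Bool; true; false; _∧_; _∨_; not)
  open import Data.Bool.Properties using (∧-identityʳ; ∧-zeroʳ; ∧-comm)
  open import Relation.Binary.PropositionalEquality as Eq using (_≡_; refl; cong; sym; trans; subst)
  open import Data.List.Relation.Unary.All as All using (All; []; _∷_)
  open import Data.Empty using (⊥-elim)
  import Data.Unit

  headIs : ℕ → List ℕ → Bool
  headIs n [] = false
  headIs n (x ∷ _) = x ≡ᵇ n

  lastIs : ℕ → List ℕ → Bool
  lastIs n [] = false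
  lastIs n (x ∷ []) = x ≡ᵇ n
  lastIs n (x ∷ y ∷ r) = lastIs n (y ∷ r)

  ≡ᵇ-< : ∀ {x n} → x < n → (x ≡ᵇ n) ≡ false
  ≡ᵇ-< {x} {n} p with x ≡ᵇ n in eq
  ... | false = refl
  ... | true = ⊥-elim (NP.<-irrefl (NP.≡ᵇ⇒≡ x n (subst Data.Bool.T (sym eq) Data.Unit.tt)) p)

  endsAscJoin : List ℕ → List ℕ → Bool
  endsAscJoin α [] = not (null α)
  endsAscJoin α (y ∷ []) = false
  endsAscJoin α (y ∷ y' ∷ r) = endsAsc (y ∷ y' ∷ r)

  startsDescJoin : List ℕ → List ℕ → Bool
  startsDescJoin [] β = not (null β)
  startsDescJoin (a ∷ []) β = false
  startsDescJoin (a ∷ a' ∷ r) β = startsDesc (a ∷ a' ∷ r)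

  null-raise : ∀ r α → null (raise r α) ≡ null α
  null-raise r [] = refl
  null-raise r (_ ∷ _) = refl

  endsAsc-raw-join : ∀ n r α β → All (_< n) (raise r α) → All (_< n) β → endsAsc (raise r α ++ n ∷ β) ≡ endsAscJoin α β
  endsAsc-raw-join n r α [] bα _ = trans (endsAsc-max-last n (raise r α) bα) (cong not (null-raise r α))
  endsAsc-raw-join n r α (y ∷ []) bα (py ∷ _) = endsAsc-max-one n (raise r α) y py
  endsAsc-raw-join n r α (y ∷ y' ∷ r') bα _ = endsAsc-max-two n (raise r α) y y' r'

  startsDesc-raw-join : ∀ n r α β → All (_< n) (raise r α) → All (_< n) β → startsDesc (raise r α ++ n ∷ β) ≡ startsDescJoin α β
  startsDesc-raw-join n r [] β _ bβ = startsDesc-max-head n β bβ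
  startsDesc-raw-join n r (a ∷ []) β (pa ∷ _) _ = startsDesc-before-max n (r + a) β pa
  startsDesc-raw-join n r (a ∷ a' ∷ r') β _ _ = lt-shift r a' a

  headIs-raw-join : ∀ n r α β → All (_< n) (raise r α) → headIs n (raise r α ++ n ∷ β) ≡ null α
  headIs-raw-join n r [] β _ = ≡ᵇ-refl n
  headIs-raw-join n r (a ∷ _) β (pa ∷ _) = ≡ᵇ-< pa

  lastIs-bounded : ∀ n ys → All (_< n) ys → lastIs n ys ≡ false
  lastIs-bounded n [] _ = refl
  lastIs-bounded n (y ∷ []) (p ∷ _) = ≡ᵇ-< p
  lastIs-bounded n (y ∷ y' ∷ ys) (_ ∷ ps) = lastIs-bounded n (y' ∷ ys) ps

  lastIs-++ : ∀ n xs ys → All (_< n) ys → lastIs n (xs ++ n ∷ ys) ≡ null ys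
  lastIs-++ n [] [] _ = ≡ᵇ-refl n
  lastIs-++ n [] (y ∷ ys) ps = lastIs-bounded n (y ∷ ys) ps
  lastIs-++ n (x ∷ []) ys ps = lastIs-++ n [] ys ps
  lastIs-++ n (x ∷ x' ∷ xs) ys ps = lastIs-++ n (x' ∷ xs) ys ps

  module _ {n m : ℕ} {α β : List ℕ} (m≤n : m ≤ n) (iα : InS m α) (iβ : InS (n ∸ m) β) where

    endsAsc-join : endsAsc (join n m α β) ≡ endsAscJoin α β
    endsAsc-join = endsAsc-raw-join n (n ∸ m) α β (join-boundˡ m≤n iα) (join-boundʳ {n} {m} iβ)

    startsDesc-join : startsDesc (join n m α β) ≡ startsDescJoin α β
    startsDesc-join = startsDesc-raw-join n (n ∸ m) α β (join-boundˡ m≤n iα) (join-boundʳ {n} {m} iβ)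

    headIs-join : headIs n (join n m α β) ≡ null α
    headIs-join = headIs-raw-join n (n ∸ m) α β (join-boundˡ m≤n iα)

    lastIs-join : lastIs n (join n m α β) ≡ null β
    lastIs-join = lastIs-++ n (raise (n ∸ m) α) β (join-boundʳ {n} {m} iβ)

  maxLast-split : ∀ α β → not (endsAscJoin α β) ∧ null β ≡ null α ∧ null β
  maxLast-split [] [] = refl
  maxLast-split (_ ∷ _) [] = refl
  maxLast-split [] (y ∷ []) = refl
  maxLast-split (_ ∷ _) (y ∷ []) = refl
  maxLast-split [] (y ∷ y' ∷ r) = ∧-zeroʳ _
  maxLast-split (_ ∷ _) (y ∷ y' ∷ r) = ∧-zeroʳ _

  maxNotLast-split : ∀ α β → not (endsAscJoin α β) ∧ not (null β) ≡ true ∧ (not (endsAsc β) ∧ not (null β))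
  maxNotLast-split α [] = ∧-zeroʳ _
  maxNotLast-split α (y ∷ []) = refl
  maxNotLast-split α (y ∷ y' ∷ r) = refl

  noEndAscDesc-split : ∀ α β → not (endsAscJoin α β) ∧ startsDescJoin α β ≡ (null α ∨ startsDesc α) ∧ (not (endsAsc β) ∧ not (null β))
  noEndAscDesc-split [] [] = refl
  noEndAscDesc-split [] (y ∷ []) = refl
  noEndAscDesc-split [] (y ∷ y' ∷ r) = refl
  noEndAscDesc-split (a ∷ []) β = ∧-zeroʳ _
  noEndAscDesc-split (a ∷ a' ∷ r) [] = sym (∧-zeroʳ _)
  noEndAscDesc-split (a ∷ a' ∷ r) (y ∷ []) = sym (∧-identityʳ _)
  noEndAscDesc-split (a ∷ a' ∷ r) (y ∷ y' ∷ r') =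
    trans (∧-comm (not (endsAsc (y ∷ y' ∷ r'))) (startsDesc (a ∷ a' ∷ r)))
          (cong (startsDesc (a ∷ a' ∷ r) ∧_) (sym (∧-identityʳ (not (endsAsc (y ∷ y' ∷ r'))))))

  maxFirst-split : ∀ α β → startsDescJoin α β ∧ null α ≡ null α ∧ not (null β)
  maxFirst-split [] β = ∧-identityʳ _
  maxFirst-split (a ∷ []) β = refl
  maxFirst-split (a ∷ a' ∷ r) β = ∧-zeroʳ _

  maxNotFirst-split : ∀ α β → startsDescJoin α β ∧ not (null α) ≡ startsDesc α ∧ true
  maxNotFirst-split [] [] = refl
  maxNotFirst-split [] (_ ∷ _) = refl
  maxNotFirst-split (a ∷ []) β = refl
  maxNotFirst-split (a ∷ a' ∷ r) β = refl

  nonemptyNoEndAsc : List ℕ → Bool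
  nonemptyNoEndAsc β = not (endsAsc β) ∧ not (null β)

  module JoinClasses (n : ℕ) where
    open Products using (Compatible)

    maxLast : Compatible n (λ σ → not (endsAsc σ) ∧ lastIs n σ) null null
    maxLast m α β p iα iβ _ rewrite endsAsc-join p iα iβ | lastIs-join p iα iβ = maxLast-split α β

    maxNotLast : Compatible n (λ σ → not (endsAsc σ) ∧ not (lastIs n σ)) (λ _ → true) nonemptyNoEndAsc
    maxNotLast m α β p iα iβ _ rewrite endsAsc-join p iα iβ | lastIs-join p iα iβ = maxNotLast-split α β

    noEndAscDesc : Compatible n (λ σ → not (endsAsc σ) ∧ startsDesc σ) (λ α → null α ∨ startsDesc α) nonemptyNoEndAsc
    noEndAscDesc m α β p iα iβ _ rewrite endsAsc-join p iα iβ | startsDesc-join p iα iβ = noEndAscDesc-split α β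

    maxFirst : Compatible n (λ σ → startsDesc σ ∧ headIs n σ) null (λ β → not (null β))
    maxFirst m α β p iα iβ _ rewrite startsDesc-join p iα iβ | headIs-join p iα iβ = maxFirst-split α β

    maxNotFirst : Compatible n (λ σ → startsDesc σ ∧ not (headIs n σ)) startsDesc (λ _ → true)
    maxNotFirst m α β p iα iβ _ rewrite startsDesc-join p iα iβ | headIs-join p iα iβ = maxNotFirst-split α β


module Rearrangements where

  open import Data.Integer using (+_)
  open Bivariate
  open CommutativeRing SerRing
  open Solver using (solve; _:=_; _:+_; _:*_; _:-_; con)

  minus-one : ∀ S v → S ≈ 1# + v → v ≈ S - 1#
  minus-one S v e = trans (solve 1 (λ v → v := (con (+ 1) :+ v) :- con (+ 1)) refl v) (+-congʳ (sym e))

  t-weight : ∀ a b t → (b + a) + (t - 1#) * b ≈ a + t * b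
  t-weight = solve 3 (λ a b t → (b :+ a) :+ (t :- con (+ 1)) :* b := a :+ t :* b) refl

  minus-one-weighted : ∀ a t s → (a - 1#) + (t - 1#) * s ≈ (a + (t - 1#) * s) - 1#
  minus-one-weighted = solve 3 (λ a t s →
    (a :- con (+ 1)) :+ (t :- con (+ 1)) :* s := (a :+ (t :- con (+ 1)) :* s) :- con (+ 1)) refl

  shape-F : ∀ x a q → 1# + x * (a * q) ≈ 1# + x * a * q
  shape-F = solve 3 (λ x a q → con (+ 1) :+ x :* (a :* q) := con (+ 1) :+ x :* a :* q) refl

  shape-A : ∀ x a p → 1# + x * (1# * 1# + a * p) ≈ 1# + x + x * a * p
  shape-A = solve 3 (λ x a p →
    con (+ 1) :+ x :* (con (+ 1) :* con (+ 1) :+ a :* p) := con (+ 1) :+ x :+ x :* a :* p) refl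

  shape-A' : ∀ x a p → 0# + x * ((1# + a) * p) ≈ x * (1# + a) * p
  shape-A' x a p = trans (+-identityˡ _) (sym (*-assoc x (1# + a) p))

  shape-B : ∀ x q s → 0# + x * (1# * (q - 1#) + s * q) ≈ x * (q - 1#) + x * s * q
  shape-B x q s = trans (+-identityˡ _) (solve 3 (λ x q s →
    x :* (con (+ 1) :* (q :- con (+ 1)) :+ s :* q) := x :* (q :- con (+ 1)) :+ x :* s :* q) refl x q s)

  P-minus-one : ∀ x h → (1# + x * h) - 1# ≈ x * h
  P-minus-one = solve 2 (λ x h → (con (+ 1) :+ x :* h) :- con (+ 1) := x :* h) refl


module ClassSeries (f : ℕ → ℕ → ℕ) (hyp : ∀ n k → IsCount (λ σ → InS n σ × occ321 σ ≡ k) (f n k)) where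

  open Patterns
  open JoinInjective
  open Products
  open BoundaryStatistics
  open ListEnumeration
  open DistinctLists using (same-length)
  open Bivariate
  open Monomials
  open Rearrangements
  open import Data.Nat as ℕ using (zero; suc)
  open import Data.Integer as ℤ using (+_)
  import Data.Integer.Properties as ℤP
  open import Data.Nat.Properties using (1+n≢0)
  open import Data.List using (List; []; _∷_; length; null)
  import Data.List.Properties as LP
  open import Data.Product using (_,_; proj₁; proj₂)
  open import Data.Bool using (Bool; true; false; _∧_; _∨_; not; if_then_else_)
  open import Data.Bool.Properties using (∧-identityʳ)
  open import Data.Empty using (⊥-elim)
  open import Relation.Binary.PropositionalEquality as Eq using (refl; cong; subst)
  open import Function.Bundles using (_⇔_; mk⇔)
  open import Data.List.Relation.Unary.Any using (here)
  import Data.List.Relation.Unary.All as All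
  open import Data.List.Relation.Unary.AllPairs using ([]; _∷_)
  open import Data.List.Membership.Propositional using (_∈_)
  open import Data.List.Relation.Unary.Unique.Propositional using (Unique)
  import Data.List.Relation.Binary.Permutation.Propositional.Properties as PP
  open import Data.List.Relation.Binary.Permutation.Propositional using (↭-refl)
  open CommutativeRing SerRing using (_+_; _*_; _-_; -_; 0#; 1#; _≈_; setoid; +-congˡ; +-congʳ; zeroʳ; +-identityʳ)
  open import Relation.Binary.Reasoning.Setoid setoid

  L : ℕ → ℕ → List (List ℕ)
  L n k = proj₁ (hyp n k)

  L-Unique : ∀ n k → Unique (L n k)
  L-Unique n k = proj₁ (proj₂ (hyp n k))

  L-members : ∀ n k σ → (σ ∈ L n k) ⇔ (InS n σ × occ321 σ ≡ k)
  L-members n k σ = proj₁ (proj₂ (proj₂ (hyp n k))) σ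

  open ProductFormula L L-Unique L-members public

  count-all : ∀ n k → count (λ _ → true) n k ≡ f n k
  count-all n k = Eq.trans (cong length (select-all (L n k))) (proj₂ (proj₂ (proj₂ (hyp n k))))
    where
    select-all : ∀ (xs : List (List ℕ)) → select (λ _ → true) xs ≡ xs
    select-all [] = refl
    select-all (x ∷ xs) = cong (x ∷_) (select-all xs)

  InS-empty : InS 0 []
  InS-empty = ↭-refl , (λ { (_ , _ , _ , () , _) }) , (λ { ([] , _ , _ , _ , _ , () , _) ; (_ ∷ _ , _ , _ , _ , _ , () , _) })

  size-zero : ∀ {k σ} → σ ∈ L 0 k → σ ≡ [] × k ≡ 0
  size-zero p with inL⁻ p
  ... | (pσ , _) , o with PP.↭-empty-inv pσ
  ... | refl = refl , Eq.sym o

  count-empty : ∀ p → count p 0 0 ≡ (if p [] then 1 else 0)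
  count-empty p with p [] in eq
  ... | false = cong length (select-none p (L 0 0) (λ σ σ∈ → subst (λ z → p z ≡ false) (Eq.sym (proj₁ (size-zero σ∈))) eq))
  ... | true = same-length (select-Unique p (L-Unique 0 0)) (All.[] ∷ []) (mk⇔ to from)
    where
    to : ∀ {σ} → σ ∈ select p (L 0 0) → σ ∈ ([] ∷ [])
    to σ∈ with size-zero (select-⊆ p (L 0 0) σ∈)
    ... | refl , _ = here refl
    from : ∀ {σ} → σ ∈ ([] ∷ []) → σ ∈ select p (L 0 0)
    from (here refl) = select-∈⁺ p (inL⁺ InS-empty refl) eq

  count-size0 : ∀ p k → count p 0 (suc k) ≡ 0
  count-size0 p k = cong length (select-none p (L 0 (suc k)) λ σ σ∈ → ⊥-elim (1+n≢0 (proj₂ (size-zero σ∈))))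

  count-onlyEmpty-suc : ∀ p n k → (∀ σ → p σ ≡ true → null σ ≡ true) → count p (suc n) k ≡ 0
  count-onlyEmpty-suc p n k h = cong length (select-none p (L (suc n) k) excluded)
    where
    excluded : ∀ σ → σ ∈ L (suc n) k → p σ ≡ false
    excluded σ σ∈ with p σ in eq
    ... | false = refl
    ... | true with σ | h σ eq | InS-length (proj₁ (inL⁻ σ∈))
    ... | [] | _ | ()

  count-onlyEmpty : ∀ p → (∀ σ → p σ ≡ true → null σ ≡ true) → ∀ b → p [] ≡ b →
                    ofℕ (count p) ≈ (if b then 1# else 0#)
  count-onlyEmpty p h true e zero zero = cong +_ (Eq.trans (count-empty p) (cong (λ b → if b then 1 else 0) e))
  count-onlyEmpty p h false e zero zero = cong +_ (Eq.trans (count-empty p) (cong (λ b → if b then 1 else 0) e))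
  count-onlyEmpty p h true e zero (suc k) = cong +_ (count-size0 p k)
  count-onlyEmpty p h false e zero (suc k) = cong +_ (count-size0 p k)
  count-onlyEmpty p h true e (suc n) k = cong +_ (count-onlyEmpty-suc p n k h)
  count-onlyEmpty p h false e (suc n) k = cong +_ (count-onlyEmpty-suc p n k h)

  series-by-x-degree : ∀ (c : ℕ → ℕ → ℕ) (Z W : Ser) → (∀ k → + c 0 k ≡ Z 0 k) →
                       (∀ n k → + c (suc n) k ≡ Z (suc n) k ℤ.+ W n k) → ofℕ c ≈ Z + X * W
  series-by-x-degree c Z W h0 hs zero k =
    Eq.trans (h0 k) (Eq.sym (Eq.trans (cong (λ z → Z 0 k ℤ.+ z) (X*≈shift W 0 k)) (ℤP.+-identityʳ (Z 0 k))))
  series-by-x-degree c Z W h0 hs (suc n) k =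
    Eq.trans (hs n k) (cong (λ z → Z (suc n) k ℤ.+ z) (Eq.sym (X*≈shift W (suc n) k)))

  count-suc : ∀ q ua vb n k → Compatible n q ua vb → ∀ U V → ofℕ (leftCount ua) ≈ U → ofℕ (weightedCount vb) ≈ V → + count q (suc n) k ≡ (U * V) n k
  count-suc q ua vb n k compatible U V eU eV = Eq.trans (product-formula q ua vb n k compatible)
    (Eq.trans (⊛≐conv (ofℕ (leftCount ua)) (ofℕ (weightedCount vb)) n k)
              (Ztx.conv-cong {ofℕ (leftCount ua)} {U} {ofℕ (weightedCount vb)} {V} eU eV n k))

  count-split : ∀ p q → ofℕ (count p) ≈ ofℕ (count (λ x → p x ∧ q x)) + ofℕ (count (λ x → p x ∧ not (q x)))
  count-split p q n k = Eq.trans (cong +_ (select-split p q (L n k)))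
    (ℤP.pos-+ (count (λ x → p x ∧ q x) n k) (count (λ x → p x ∧ not (q x)) n k))

  count-cong : ∀ p p' → (∀ σ → p σ ≡ p' σ) → ofℕ (count p) ≈ ofℕ (count p')
  count-cong p p' e n k = cong (λ z → + length z) (select-cong p p' (L n k) (λ σ _ → e σ))

  weighted-series : ∀ vb → ofℕ (weightedCount vb) ≈
    ofℕ (count (λ β → vb β ∧ not (startsDesc β))) + T * ofℕ (count (λ β → vb β ∧ startsDesc β))
  weighted-series vb r zero = Eq.sym (Eq.trans
    (cong (λ z → + count (λ β → vb β ∧ not (startsDesc β)) r 0 ℤ.+ z) (T*-coefficient (ofℕ (count (λ β → vb β ∧ startsDesc β))) r 0))
    (ℤP.+-identityʳ _))
  weighted-series vb r (suc i) = Eq.trans (cong +_ (LP.length-++ (select (λ β → vb β ∧ not (startsDesc β)) (L r (suc i)))))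
    (Eq.trans (ℤP.pos-+ (count (λ β → vb β ∧ not (startsDesc β)) r (suc i)) (count (λ β → vb β ∧ startsDesc β) r i))
      (cong (λ z → + count (λ β → vb β ∧ not (startsDesc β)) r (suc i) ℤ.+ z)
        (Eq.sym (T*-coefficient (ofℕ (count (λ β → vb β ∧ startsDesc β))) r (suc i)))))

  weighted-series′ : ∀ vb → ofℕ (weightedCount vb) ≈ ofℕ (count vb) + (T - 1#) * ofℕ (count (λ β → vb β ∧ startsDesc β))
  weighted-series′ vb = begin
    ofℕ (weightedCount vb)   ≈⟨ weighted-series vb ⟩
    a + T * b               ≈⟨ sym (t-weight a b T) ⟩
    (b + a) + (T - 1#) * b  ≈⟨ +-congʳ {(T - 1#) * b} (sym (count-split vb startsDesc)) ⟩
    ofℕ (count vb) + (T - 1#) * b ∎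
    where
    open CommutativeRing SerRing using (sym)
    a b : Ser
    a = ofℕ (count (λ β → vb β ∧ not (startsDesc β)))
    b = ofℕ (count (λ β → vb β ∧ startsDesc β))

  F A A' B Q P : Ser
  F = ofℕ f
  A = ofℕ (count (λ σ → not (endsAsc σ)))
  A' = ofℕ (count (λ σ → not (endsAsc σ) ∧ startsDesc σ))
  B = ofℕ (count startsDesc)
  Q = F + (T - 1#) * B
  P = A + (T - 1#) * A'

  ∧-true₂ : ∀ {a b} → a ∧ b ≡ true → b ≡ true
  ∧-true₂ {true} {true} _ = refl

  ∧-true₁ : ∀ {a b} → a ∧ b ≡ true → a ≡ true
  ∧-true₁ {true} {true} _ = refl

  F-count : ofℕ (count (λ _ → true)) ≈ F
  F-count n k = cong +_ (count-all n k)

  left-all : ofℕ (leftCount (λ _ → true)) ≈ A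
  left-all = count-cong (λ α → not (endsAsc α) ∧ true) (λ α → not (endsAsc α)) (λ α → ∧-identityʳ (not (endsAsc α)))

  left-empty : ofℕ (leftCount null) ≈ 1#
  left-empty = count-onlyEmpty (λ α → not (endsAsc α) ∧ null α) (λ σ e → ∧-true₂ e) true refl

  left-emptyOrDesc : ofℕ (leftCount (λ α → null α ∨ startsDesc α)) ≈ 1# + A'
  left-emptyOrDesc = begin
    ofℕ (leftCount (λ α → null α ∨ startsDesc α))
      ≈⟨ count-split p null ⟩
    ofℕ (count (λ x → p x ∧ null x)) + ofℕ (count (λ x → p x ∧ not (null x)))
      ≈⟨ CommutativeRing.+-cong SerRing (count-onlyEmpty (λ x → p x ∧ null x) (λ σ e → ∧-true₂ e) true refl)
                                         (count-cong (λ x → p x ∧ not (null x)) (λ σ → not (endsAsc σ) ∧ startsDesc σ) desc) ⟩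
    1# + A' ∎
    where
    p : List ℕ → Bool
    p α = not (endsAsc α) ∧ (null α ∨ startsDesc α)
    desc : ∀ σ → (not (endsAsc σ) ∧ (null σ ∨ startsDesc σ)) ∧ not (null σ) ≡ not (endsAsc σ) ∧ startsDesc σ
    desc [] = refl
    desc (a ∷ []) = refl
    desc (a ∷ a' ∷ r) = ∧-identityʳ _

  weighted-all : ofℕ (weightedCount (λ _ → true)) ≈ Q
  weighted-all = CommutativeRing.trans SerRing (weighted-series′ (λ _ → true)) (+-congʳ {(T - 1#) * B} F-count)

  weighted-empty : ofℕ (weightedCount null) ≈ 1#
  weighted-empty = begin
    ofℕ (weightedCount null)
      ≈⟨ weighted-series′ null ⟩
    ofℕ (count null) + (T - 1#) * ofℕ (count (λ β → null β ∧ startsDesc β))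
      ≈⟨ CommutativeRing.+-cong SerRing (count-onlyEmpty null (λ σ e → e) true refl)
           (CommutativeRing.*-congˡ SerRing {T - 1#}
              (count-onlyEmpty (λ β → null β ∧ startsDesc β) (λ σ e → ∧-true₁ e) false refl)) ⟩
    1# + (T - 1#) * 0#  ≈⟨ +-congˡ {1#} (zeroʳ (T - 1#)) ⟩
    1# + 0#             ≈⟨ +-identityʳ 1# ⟩
    1#                  ∎

  nonempty-members : ∀ p → p [] ≡ true → ofℕ (count (λ σ → p σ ∧ not (null σ))) ≈ ofℕ (count p) - 1#
  nonempty-members p e = minus-one (ofℕ (count p)) _ (CommutativeRing.trans SerRing (count-split p null)
    (+-congʳ {ofℕ (count (λ σ → p σ ∧ not (null σ)))} (count-onlyEmpty (λ σ → p σ ∧ null σ) (λ σ e → ∧-true₂ e) true (cong (_∧ true) e))))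

  weighted-nonemptyNoEndAsc : ofℕ (weightedCount nonemptyNoEndAsc) ≈ P - 1#
  weighted-nonemptyNoEndAsc = begin
    ofℕ (weightedCount nonemptyNoEndAsc)
      ≈⟨ weighted-series′ nonemptyNoEndAsc ⟩
    ofℕ (count nonemptyNoEndAsc) + (T - 1#) * ofℕ (count (λ β → nonemptyNoEndAsc β ∧ startsDesc β))
      ≈⟨ CommutativeRing.+-cong SerRing (nonempty-members (λ σ → not (endsAsc σ)) refl)
           (CommutativeRing.*-congˡ SerRing {T - 1#}
              (count-cong (λ β → nonemptyNoEndAsc β ∧ startsDesc β) (λ σ → not (endsAsc σ) ∧ startsDesc σ) desc)) ⟩
    (A - 1#) + (T - 1#) * A'
      ≈⟨ minus-one-weighted A T A' ⟩
    P - 1# ∎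
    where
    desc : ∀ β → (not (endsAsc β) ∧ not (null β)) ∧ startsDesc β ≡ not (endsAsc β) ∧ startsDesc β
    desc [] = refl
    desc (b ∷ r) = cong (_∧ startsDesc (b ∷ r)) (∧-identityʳ (not (endsAsc (b ∷ r))))

  weighted-nonempty : ofℕ (weightedCount (λ β → not (null β))) ≈ Q - 1#
  weighted-nonempty = begin
    ofℕ (weightedCount (λ β → not (null β)))
      ≈⟨ weighted-series′ (λ β → not (null β)) ⟩
    ofℕ (count (λ β → true ∧ not (null β))) + (T - 1#) * ofℕ (count (λ β → not (null β) ∧ startsDesc β))
      ≈⟨ CommutativeRing.+-cong SerRing
           (CommutativeRing.trans SerRing (nonempty-members (λ _ → true) refl) (+-congʳ {(- 1#)} F-count))
           (CommutativeRing.*-congˡ SerRing {T - 1#} (count-cong (λ β → not (null β) ∧ startsDesc β) startsDesc desc)) ⟩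
    (F - 1#) + (T - 1#) * B
      ≈⟨ minus-one-weighted F T B ⟩
    Q - 1# ∎
    where
    desc : ∀ β → not (null β) ∧ startsDesc β ≡ startsDesc β
    desc [] = refl
    desc (b ∷ r) = refl


module FunctionalEquations (f : ℕ → ℕ → ℕ) (hyp : ∀ n k → IsCount (λ σ → InS n σ × occ321 σ ≡ k) (f n k)) where

  open ClassSeries f hyp
  open Patterns using (endsAsc; startsDesc)
  open BoundaryStatistics using (lastIs; headIs; nonemptyNoEndAsc; module JoinClasses)
  open Bivariate
  open Monomials
  open Rearrangements
  open Elimination using (quadratic)
  open UniqueSolution using (Φ)
  open import Data.Nat using (zero; suc)
  open import Data.Integer as ℤ using (+_)
  import Data.Integer.Properties as ℤP
  open import Data.List using (List; []; null)
  open import Data.Bool using (Bool; true; false; _∧_; _∨_; not; if_then_else_)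
  open import Relation.Binary.PropositionalEquality as Eq using (refl; cong; cong₂)
  open CommutativeRing SerRing using (_+_; _*_; _-_; 0#; 1#; _≈_; trans)
  open import Algebra.Properties.Group (CommutativeRing.+-group SerRing) using (x∙y⁻¹≈ε⇒x≈y)

  size0-contains-empty : ∀ p → p [] ≡ true → ∀ k → + count p 0 k ≡ 1# 0 k
  size0-contains-empty p e zero = cong +_ (Eq.trans (count-empty p) (cong (λ b → if b then 1 else 0) e))
  size0-contains-empty p e (suc k) = cong +_ (count-size0 p k)

  size0-avoids-empty : ∀ p → p [] ≡ false → ∀ k → + count p 0 k ≡ 0# 0 k
  size0-avoids-empty p e zero = cong +_ (Eq.trans (count-empty p) (cong (λ b → if b then 1 else 0) e))
  size0-avoids-empty p e (suc k) = cong +_ (count-size0 p k)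

  -- F = 1 + x·A·Q: every nonempty permutation is a join, with any right part
  equation-F : F ≈ 1# + X * A * Q
  equation-F = trans (series-by-x-degree f 1# (A * Q) at0 atSuc) (shape-F X A Q)
    where
    at0 : ∀ k → + f 0 k ≡ 1# 0 k
    at0 k = Eq.trans (cong +_ (Eq.sym (count-all 0 k))) (size0-contains-empty (λ _ → true) refl k)
    atSuc : ∀ n k → + f (suc n) k ≡ 1# (suc n) k ℤ.+ (A * Q) n k
    atSuc n k = Eq.trans (cong +_ (Eq.sym (count-all (suc n) k)))
      (Eq.trans (count-suc (λ _ → true) (λ _ → true) (λ _ → true) n k (λ _ _ _ _ _ _ _ → refl) A Q left-all weighted-all)
                (Eq.sym (ℤP.+-identityˡ _)))

  -- A = 1 + x + x·A·(P-1): split by whether the maximum comes last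
  equation-A : A ≈ 1# + X + X * A * (P - 1#)
  equation-A = trans (series-by-x-degree (count noEndAsc) 1# (1# * 1# + A * (P - 1#)) at0 atSuc) (shape-A X A (P - 1#))
    where
    noEndAsc : List ℕ → Bool
    noEndAsc σ = not (endsAsc σ)
    at0 : ∀ k → + count noEndAsc 0 k ≡ 1# 0 k
    at0 = size0-contains-empty noEndAsc refl
    atSuc : ∀ n k → + count noEndAsc (suc n) k ≡ 1# (suc n) k ℤ.+ (1# * 1# + A * (P - 1#)) n k
    atSuc n k = Eq.trans (count-split noEndAsc (lastIs n) (suc n) k)
      (Eq.trans (cong₂ ℤ._+_
          (count-suc (λ σ → noEndAsc σ ∧ lastIs n σ) null null n k (JoinClasses.maxLast n) 1# 1# left-empty weighted-empty)
          (count-suc (λ σ → noEndAsc σ ∧ not (lastIs n σ)) (λ _ → true) nonemptyNoEndAsc n k (JoinClasses.maxNotLast n)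
                     A (P - 1#) left-all weighted-nonemptyNoEndAsc))
        (Eq.sym (ℤP.+-identityˡ _)))

  -- A' = x·(1+A')·(P-1): the left part is empty or starts with a descent
  equation-A' : A' ≈ X * (1# + A') * (P - 1#)
  equation-A' = trans (series-by-x-degree (count noEndAscDesc) 0# ((1# + A') * (P - 1#)) at0 atSuc) (shape-A' X A' (P - 1#))
    where
    noEndAscDesc : List ℕ → Bool
    noEndAscDesc σ = not (endsAsc σ) ∧ startsDesc σ
    at0 : ∀ k → + count noEndAscDesc 0 k ≡ 0# 0 k
    at0 = size0-avoids-empty noEndAscDesc refl
    atSuc : ∀ n k → + count noEndAscDesc (suc n) k ≡ 0# (suc n) k ℤ.+ ((1# + A') * (P - 1#)) n k
    atSuc n k = Eq.trans
      (count-suc noEndAscDesc (λ α → null α ∨ startsDesc α) nonemptyNoEndAsc n k (JoinClasses.noEndAscDesc n)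
                 (1# + A') (P - 1#) left-emptyOrDesc weighted-nonemptyNoEndAsc)
      (Eq.sym (ℤP.+-identityˡ _))

  -- B = x·(Q-1) + x·A'·Q: split by whether the maximum comes first
  equation-B : B ≈ X * (Q - 1#) + X * A' * Q
  equation-B = trans (series-by-x-degree (count startsDesc) 0# (1# * (Q - 1#) + A' * Q) at0 atSuc) (shape-B X Q A')
    where
    at0 : ∀ k → + count startsDesc 0 k ≡ 0# 0 k
    at0 = size0-avoids-empty startsDesc refl
    atSuc : ∀ n k → + count startsDesc (suc n) k ≡ 0# (suc n) k ℤ.+ (1# * (Q - 1#) + A' * Q) n k
    atSuc n k = Eq.trans (count-split startsDesc (headIs n) (suc n) k)
      (Eq.trans (cong₂ ℤ._+_
          (count-suc (λ σ → startsDesc σ ∧ headIs n σ) null (λ β → not (null β)) n k (JoinClasses.maxFirst n)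
                     1# (Q - 1#) left-empty weighted-nonempty)
          (count-suc (λ σ → startsDesc σ ∧ not (headIs n σ)) startsDesc (λ _ → true) n k (JoinClasses.maxNotFirst n)
                     A' Q (λ _ _ → refl) weighted-all))
        (Eq.sym (ℤP.+-identityˡ _)))

  H : Ser
  H n k = P (suc n) k

  -- P has constant term 1, since A does and A' has none
  P≈1+XH : P ≈ 1# + X * H
  P≈1+XH zero k = Eq.trans (cong₂ ℤ._+_ (size0-contains-empty (λ σ → not (endsAsc σ)) refl k) weighted-A'-at0)
                           (cong (λ z → 1# 0 k ℤ.+ z) (Eq.sym (X*≈shift H 0 k)))
    where
    U : Ser
    U = T - 1#
    A'-at0 : ∀ k → A' 0 k ≡ + 0
    A'-at0 = size0-avoids-empty (λ σ → not (endsAsc σ) ∧ startsDesc σ) refl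
    weighted-A'-at0 : (U * A') 0 k ≡ + 0
    weighted-A'-at0 = Eq.trans (ℤP.+-identityʳ _)
      (Eq.trans (Zt.conv-cong {U 0} {U 0} {A' 0} {Zt.0ˢ} (λ _ → refl) A'-at0 k)
        (Eq.trans (Zt.conv-comm (U 0) Zt.0ˢ k) (Zt.conv-zeroˡ Zt.0ˢ (U 0) (λ _ → refl) k)))
  P≈1+XH (suc n) k = Eq.sym (Eq.trans (cong (λ z → + 0 ℤ.+ z) (X*≈shift H (suc n) k)) (ℤP.+-identityˡ _))

  H-solves : H ≈ Φ H
  H-solves = x∙y⁻¹≈ε⇒x≈y H (Φ H) (X-cancel (H - Φ H) (quadratic X T A A' H equation-A equation-A' P≈1+XH))


module StatementInRing where

  import Data.Integer as ℤ
  open import Relation.Binary.PropositionalEquality as Eq using (cong₂)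
  open Bivariate
  open Monomials
  open UniqueSolution using (Φ)
  open CommutativeRing SerRing using (_+_; _*_; _-_; 1#; _≈_; refl)

  ⊕-cong : ∀ {U U' V V'} → U ≐ U' → V ≐ V' → U ⊕ V ≐ U' ⊕ V'
  ⊕-cong e e' n k = cong₂ ℤ._+_ (e n k) (e' n k)

  ⊖-cong : ∀ {U U' V V'} → U ≐ U' → V ≐ V' → U ⊖ V ≐ U' ⊖ V'
  ⊖-cong e e' n k = cong₂ ℤ._-_ (e n k) (e' n k)

  ⊛-cong : ∀ U U' V V' → U ≐ U' → V ≐ V' → U ⊛ V ≐ U' * V'
  ⊛-cong U U' V V' e e' n k = Eq.trans (⊛≐conv U V n k) (Ztx.conv-cong {U} {U'} {V} {V'} e e' n k)

  x²G : ∀ G → mono 2 0 ⊛ G ≐ X * X * G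
  x²G G = ⊛-cong (mono 2 0) (X * X) G G mono-xx refl

  denominator : ∀ G → mono 0 0 ⊖ mono 2 0 ⊖ mono 1 1 ⊖ mono 2 0 ⊛ G ≐ 1# - X * X - X * T - X * X * G
  denominator G = ⊖-cong (⊖-cong (⊖-cong mono-1 mono-xx) mono-xt) (x²G G)

  numerator : ∀ G → one ⊖ mono 1 1 ⊖ mono 2 0 ⊛ G ⊕ mono 1 0 ⊖ mono 2 1 ⊕ mono 2 0 ⊖ mono 3 1 ⊕ mono 3 0
    ≐ 1# - X * T - X * X * G + X - X * X * T + X * X - X * X * X * T + X * X * X
  numerator G =
    ⊕-cong (⊖-cong (⊕-cong (⊖-cong (⊕-cong (⊖-cong (⊖-cong mono-1 mono-xt) (x²G G)) mono-x) mono-xxt) mono-xx) mono-xxxt) mono-xxx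

  equation-of-G : ∀ G → G ≐ one ⊕ mono 1 1 ⊛ G ⊕ mono 2 0 ⊛ (G ⊛ G) → G ≈ Φ G
  equation-of-G G hG = CommutativeRing.trans SerRing hG
    (⊕-cong (⊕-cong mono-1 (⊛-cong (mono 1 1) (X * T) G G mono-xt refl))
            (⊛-cong (mono 2 0) (X * X) (G ⊛ G) (G * G) mono-xx (⊛-cong G G G G refl refl)))

open Bivariate using (SerRing)
open Monomials using (X; T)
open CommutativeRing SerRing using (_+_; _*_; _-_; -_; 1#; _≈_; refl; trans; sym; +-congˡ; +-congʳ; *-congˡ)
open Elimination using (solveForF)
open UniqueSolution using (Φ-unique)
open Rearrangements using (P-minus-one)
open StatementInRing

-- The four functional
-- equations, with P - 1 = xG, determine this product (solveForF).
mainTheorem18 : (f : ℕ → ℕ → ℕ)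
    → (∀ n k → IsCount (λ σ → InS n σ × (occ321 σ ≡ k)) (f n k))
    → (G : Ser)
    → G ≐ one ⊕ mono 1 1 ⊛ G ⊕ mono 2 0 ⊛ (G ⊛ G)
    → ofℕ f ⊛ (mono 0 0 ⊖ mono 2 0 ⊖ mono 1 1 ⊖ mono 2 0 ⊛ G)
      ≐ one ⊖ mono 1 1 ⊖ mono 2 0 ⊛ G ⊕ mono 1 0 ⊖ mono 2 1 ⊕ mono 2 0
        ⊖ mono 3 1 ⊕ mono 3 0
mainTheorem18 f hyp G hG =
  trans (⊛-cong (ofℕ f) F _ _ refl (denominator G))
    (trans (solveForF X T F A A' B G equation-F equation-A[G] equation-A'[G] equation-B)
           (sym (numerator G)))
  where
  open ClassSeries f hyp using (F; A; A'; B; P)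
  open FunctionalEquations f hyp
  -- H and G solve the same equation, which has a unique solution
  H≈G : H ≈ G
  H≈G = Φ-unique H G H-solves (equation-of-G G hG)
  P-1≈XG : P - 1# ≈ X * G
  P-1≈XG = trans (+-congʳ {(- 1#)} P≈1+XH) (trans (P-minus-one X H) (*-congˡ {X} H≈G))
  equation-A[G] : A ≈ 1# + X + X * A * (X * G)
  equation-A[G] = trans equation-A (+-congˡ {1# + X} (*-congˡ {X * A} P-1≈XG))
  equation-A'[G] : A' ≈ X * (1# + A') * (X * G)
  equation-A'[G] = trans equation-A' (*-congˡ {X * (1# + A')} P-1≈XG)
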